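{- Let $n\ge 2$ and $0\le j\le n-1$. Let $x[1\colon n]$ be an array of $n$ distinct keys with pivot $v:=x_1$, such that exactly $j$ of the keys $x_2,\dots,x_n$ are smaller than $v$, and such that all $(n-1)!$ arrangements of the keys in $x[2\colon n]$ are equally likely. Let $T_j^{A}$, $T_j^{B}$, $T_j^{C}$, $T_j^{D}$ denote the average numbers of swaps made by Schemes A, B, C, D (defined in the context), excluding the swaps of their final (cleanup) step. Then $$T_j^{A}=\frac{j(n-1-j)}{n-1}\cdot\frac{n-3}{n-2}+\frac{j}{n-1}\quad\text{if } n\ge 3,\qquad T_j^{A}=\frac{j}{n-1}\quad\text{if } n=2,$$ $$T_j^{B}=T_j^{C}=\frac{j(n-1-j)}{n-1},\qquad T_j^{D}=j.$$
   Context: All schemes partition an array $x[1\colon n]$ ($n\ge2$) around the pivot value $v:=x_1$ (the value $v$ is stored, so later comparisons with $v$ use this value even if $x_1$ is moved). A "swap" or "exchange" $x_a\leftrightarrow x_b$ counts as one swap even if $a=b$. Scheme A (safeguarded binary partition): A1. Set $i:=1$, $p:=2$, $j:=n$, $q:=n-1$. If $v>x_j$, exchange $x_i\leftrightarrow x_j$ and set $p:=i$; else if $v<x_j$, set $q:=j$. A2. Increase $i$ by 1; then if $x_i<v$, repeat A2. A3. Decrease $j$ by 1; then if $x_j>v$, repeat A3. A4. If $i<j$, exchange $x_i\leftrightarrow x_j$ and return to A2. If $i=j$, increase $i$ by 1 and decrease $j$ by 1. A5 (final step). If $1<p$, exchange $x_1\leftrightarrow x_j$; if $q<n$, exchange $x_i\leftrightarrow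 x_n$. Scheme B (single-index controlled binary partition): B1. Set $i:=1$, $j:=n+1$. B2. Increase $i$ by 1; then if $i\le n$ and $x_i<v$, repeat B2. B3. Decrease $j$ by 1; then if $x_j>v$, repeat B3. B4. If $i<j$, exchange $x_i\leftrightarrow x_j$ and return to B2. If $i=j$, increase $i$ by 1 and decrease $j$ by 1. B5 (final step). Exchange $x_1\leftrightarrow x_j$. Scheme C (double-index controlled binary partition): C1. Set $i:=2$, $j:=n$. C2. If $i\le j$ and $x_i<v$, increase $i$ by 1 and repeat C2. C3. If $i<j$ and $x_j>v$, decrease $j$ by 1 and repeat C3. If $i\ge j$, set $j:=i-1$ and go to C5. C4. Exchange $x_i\leftrightarrow x_j$, increase $i$ by 1, decrease $j$ by 1, and return to C2. C5 (final step). Exchange $x_1\leftrightarrow x_j$. Scheme D (Lomuto's binary partition): D1. Set $i:=2$, $p:=1$. D2. If $i>n$, go to D4. D3. If $x_i<v$, increase $p$ by 1 and exchange $x_p\leftrightarrow x_i$. Increase $i$ by 1 and return to D2. D4 (final step). Exchange $x_1\leftrightarrow x_p$. -}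

module Defs where

open import Data.Nat using (ℕ; zero; suc; _+_; _*_; _∸_; _<ᵇ_; _≡ᵇ_)
open import Data.Bool using (Bool; true; false; if_then_else_; _∧_; not)
open import Data.List using (List; []; _∷_; map; concatMap; length)
open import Data.Nat.ListAction using (sum)
open import Data.Integer using (+_)
open import Data.Rational using (ℚ; _/_; 0ℚ) renaming (_+_ to _+ℚ_; _*_ to _*ℚ_)

-- Arrays: a function  ℕ → ℕ , read with 1-based indices 1..n.

Array : Set
Array = ℕ → ℕ

swap : Array → ℕ → ℕ → Array
swap x a b k = if k ≡ᵇ a then x b else (if k ≡ᵇ b then x a else x k)

-- the array x[1:n] with x_1 = v and x[2:n] = ks  (other positions: 0, never read)
toArr : ℕ → List ℕ → Array
toArr v ks zero = 0
toArr v ks (suc zero) = v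
toArr v [] (suc (suc k)) = 0
toArr v (y ∷ ys) (suc (suc zero)) = y
toArr v (y ∷ ys) (suc (suc (suc k))) = toArr v ys (suc (suc k))

_≤ᵇ_ : ℕ → ℕ → Bool
a ≤ᵇ b = a <ᵇ suc b

-- generous fuel bound; each step of the loops below consumes one unit
fuel : ℕ → ℕ
fuel n = (n + 2) * (n + 2)

-- Each scheme returns the number of swaps performed, EXCLUDING the
-- swaps of the final (cleanup) step.  Arguments: fuel, pivot value v,
-- current array, indices, swap counter so far.

-- Scheme A (steps A2–A4; A5 is the excluded final step)
mutual
  stepA2 : ℕ → ℕ → Array → ℕ → ℕ → ℕ → ℕ
  stepA2 zero v x i j c = c
  stepA2 (suc f) v x i j c =
    if x (suc i) <ᵇ v then stepA2 f v x (suc i) j c else stepA3 f v x (suc i) j c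

  stepA3 : ℕ → ℕ → Array → ℕ → ℕ → ℕ → ℕ
  stepA3 zero v x i j c = c
  stepA3 (suc f) v x i j c =
    if v <ᵇ x (j ∸ 1) then stepA3 f v x i (j ∸ 1) c else stepA4 f v x i (j ∸ 1) c

  stepA4 : ℕ → ℕ → Array → ℕ → ℕ → ℕ → ℕ
  stepA4 f v x i j c =
    if i <ᵇ j then stepA2 f v (swap x i j) i j (suc c) else c

-- A1 (counts the possible exchange x_1 ↔ x_n), then A2–A4
swapsA : ℕ → Array → ℕ
swapsA n x =
  let v = x 1 in
  if x n <ᵇ v
    then stepA2 (fuel n) v (swap x 1 n) 1 n 1
    else stepA2 (fuel n) v x 1 n 0

-- Scheme B (steps B2–B4; B5 is the excluded final step)
mutual
  stepB2 : ℕ → ℕ → ℕ → Array → ℕ → ℕ → ℕ → ℕ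
  stepB2 n zero v x i j c = c
  stepB2 n (suc f) v x i j c =
    if (suc i ≤ᵇ n) ∧ (x (suc i) <ᵇ v)
      then stepB2 n f v x (suc i) j c else stepB3 n f v x (suc i) j c

  stepB3 : ℕ → ℕ → ℕ → Array → ℕ → ℕ → ℕ → ℕ
  stepB3 n zero v x i j c = c
  stepB3 n (suc f) v x i j c =
    if v <ᵇ x (j ∸ 1) then stepB3 n f v x i (j ∸ 1) c else stepB4 n f v x i (j ∸ 1) c

  stepB4 : ℕ → ℕ → ℕ → Array → ℕ → ℕ → ℕ → ℕ
  stepB4 n f v x i j c =
    if i <ᵇ j then stepB2 n f v (swap x i j) i j (suc c) else c

swapsB : ℕ → Array → ℕ
swapsB n x = stepB2 n (fuel n) (x 1) x 1 (suc n) 0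

-- Scheme C (steps C2–C4; C5 is the excluded final step)
mutual
  stepC2 : ℕ → ℕ → Array → ℕ → ℕ → ℕ → ℕ
  stepC2 zero v x i j c = c
  stepC2 (suc f) v x i j c =
    if (i ≤ᵇ j) ∧ (x i <ᵇ v) then stepC2 f v x (suc i) j c else stepC3 f v x i j c

  stepC3 : ℕ → ℕ → Array → ℕ → ℕ → ℕ → ℕ
  stepC3 zero v x i j c = c
  stepC3 (suc f) v x i j c =
    if (i <ᵇ j) ∧ (v <ᵇ x j) then stepC3 f v x i (j ∸ 1) c
    else (if j ≤ᵇ i then c                      -- i ≥ j : go to C5
          else stepC2 f v (swap x i j) (suc i) (j ∸ 1) (suc c))

swapsC : ℕ → Array → ℕ
swapsC n x = stepC2 (fuel n) (x 1) x 2 n 0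

-- Scheme D (steps D2–D3; D4 is the excluded final step)
stepD : ℕ → ℕ → ℕ → Array → ℕ → ℕ → ℕ → ℕ
stepD n zero v x i p c = c
stepD n (suc f) v x i p c =
  if n <ᵇ i then c
  else (if x i <ᵇ v then stepD n f v (swap x (suc p) i) (suc i) (suc p) (suc c)
        else stepD n f v x (suc i) p c)

swapsD : ℕ → Array → ℕ
swapsD n x = stepD n (fuel n) (x 1) x 2 1 0

insertAll : {A : Set} → A → List A → List (List A)
insertAll x [] = (x ∷ []) ∷ []
insertAll x (y ∷ ys) = (x ∷ y ∷ ys) ∷ map (y ∷_) (insertAll x ys)

arrangements : {A : Set} → List A → List (List A)
arrangements [] = [] ∷ []
arrangements (x ∷ xs) = concatMap (insertAll x) (arrangements xs)

-- arithmetic mean of a list of naturals, as a rational (0 for the empty list)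
mean : List ℕ → ℚ
mean [] = 0ℚ
mean (a ∷ as) = (+ sum (a ∷ as)) / length (a ∷ as)

avgSwaps : (ℕ → Array → ℕ) → ℕ → ℕ → List ℕ → ℚ
avgSwaps scheme n v ks = mean (map (λ p → scheme n (toArr v p)) (arrangements ks))

-- The closed forms (n ≥ 2 in the theorem; other n are irrelevant).

formulaA : ℕ → ℕ → ℚ
formulaA (suc (suc zero)) j = (+ j) / 1
formulaA (suc (suc (suc k))) j =
  ((+ (j * (suc (suc k) ∸ j))) / suc (suc k)) *ℚ ((+ k) / suc k)
  +ℚ ((+ j) / suc (suc k))
formulaA _ j = 0ℚ

formulaBC : ℕ → ℕ → ℚ
formulaBC (suc (suc k)) j = (+ (j * (suc k ∸ j))) / suc k
formulaBC _ j = 0ℚ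

{-# OPTIONS --safe #-}
-- Call a key small or large according as it is below or above the pivot v, and let s be the
-- number of small keys, which have to end up at positions 2 .. s + 1. Every exchange of Schemes
-- B and C swaps a large key at a position ≤ s + 1 with a small key at a position > s + 1, and
-- their scans stop exactly when the keys are partitioned, so both make as many exchanges as there
-- are large keys among x₂ … x_{s+1}. Once step A1 has put a key ≥ v at position n (one exchange
-- iff x_n < v), Scheme A runs like Scheme B on x[2:n-1]; Scheme D exchanges once per small key.
-- The arrangements of a list are obtained by inserting its head at every position of every
-- arrangement of its tail. By induction along this construction, over the arrangements of k + 1
-- keys of which ℓ are large, the numbers of large keys among the first t sum to t ℓ k!, and over
-- those of k + 2 keys with j small ones, weighted by the indicator of a small last key, to t j ℓ k!
-- (t ≤ k + 1). Scheme A makes 1 + (large keys among the first j - 1) exchanges if x_n is small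
-- and (large keys among the first j) otherwise, which sums to j (k+1)! + j ℓ k k!.
module Submission where

open import Defs
open import Data.Nat using (ℕ; _≤_; _∸_; _<?_)
open import Data.List using (List; _∷_; length; filter)
open import Data.List.Relation.Unary.Unique.Propositional using (Unique)
open import Data.Integer using (+_)
open import Data.Rational using (ℚ; _/_)
open import Data.Product using (_×_)
open import Relation.Binary.PropositionalEquality using (_≡_)

open import Data.Bool using (Bool; true; false; if_then_else_; _∧_; not)
open import Data.Bool.Properties using (∧-inverseʳ)
open import Data.Empty using (⊥; ⊥-elim)
import Data.Integer as ℤ
open import Data.Integer.Properties using (pos-*; pos-+)
open import Data.List using ([]; map; concatMap; take; _++_)
open import Data.List.Properties using (take-all; length-map; length-++; map-++; map-∘; map-cong; map-cong-local)
open import Data.List.Relation.Binary.Permutation.Propositional as ↭ using (_↭_)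
open import Data.List.Relation.Binary.Permutation.Propositional.Properties
  using (All-resp-↭; ↭-length) renaming (map⁺ to ↭-map⁺)
open import Data.List.Relation.Unary.All as All using (All; []; _∷_)
import Data.List.Relation.Unary.All.Properties as All
open import Data.List.Relation.Unary.AllPairs using (_∷_)
open import Data.Nat using (NonZero; zero; suc; _+_; _*_; _<_; _<ᵇ_; _≡ᵇ_; _!; z≤n; s≤s; z<s)
open import Data.Nat.ListAction using (sum)
open import Data.Nat.ListAction.Properties using (sum-++; sum-↭)
open import Data.Nat.Properties
open import Data.Nat.Tactic.RingSolver using (solve-∀)
open import Data.Product using (_,_)
open import Data.Rational using (fromℚᵘ) renaming (_+_ to _+ℚ_; _*_ to _*ℚ_)
open import Data.Rational.Properties
  using (fromℚᵘ-cong; fromℚᵘ-toℚᵘ; toℚᵘ-fromℚᵘ; toℚᵘ-homo-+; toℚᵘ-homo-*)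
open import Data.Rational.Unnormalised as ℚᵘ using (mkℚᵘ; *≡*)
import Data.Rational.Unnormalised.Properties as ℚᵘ
open import Data.Sum using (inj₁; inj₂)
open import Function using (_∘_)
open import Relation.Binary.PropositionalEquality
  using (_≢_; refl; sym; trans; cong; cong₂; subst; module ≡-Reasoning)
open import Relation.Nullary using (¬_; yes; no)
open import Relation.Nullary.Reflects using (ofʸ; ofⁿ)

toℕ : Bool → ℕ
toℕ false = 0
toℕ true  = 1

toℕ≤1 : ∀ b → toℕ b ≤ 1
toℕ≤1 false = z≤n
toℕ≤1 true  = ≤-refl

-- Counting positions of an array

countFrom : (ℕ → Bool) → ℕ → ℕ → ℕ
countFrom P lo zero      = 0
countFrom P lo (suc len) = toℕ (P lo) + countFrom P (suc lo) len

Within : ℕ → ℕ → (ℕ → Set) → Set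
Within lo len Q = ∀ k → lo ≤ k → k < lo + len → Q k

within-suc : ∀ {lo len Q} → Within lo (suc len) Q → Within (suc lo) len Q
within-suc {lo} {len} h k lo<k k<end = h k (<⇒≤ lo<k) (subst (k <_) (sym (+-suc lo len)) k<end)

lo<lo+suc : ∀ lo len → lo < lo + suc len
lo<lo+suc lo len = m<m+n lo z<s

empty-range : ∀ {lo a} → lo ≤ a → a < lo + 0 → ⊥
empty-range {lo} {a} lo≤a a<lo+0 = <⇒≱ a<lo+0 (subst (_≤ a) (sym (+-identityʳ lo)) lo≤a)

countFrom-cong : ∀ P Q lo len → Within lo len (λ k → P k ≡ Q k) →
                 countFrom P lo len ≡ countFrom Q lo len
countFrom-cong P Q lo zero      eq = refl
countFrom-cong P Q lo (suc len) eq =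
  cong₂ _+_ (cong toℕ (eq lo ≤-refl (lo<lo+suc lo len)))
            (countFrom-cong P Q (suc lo) len (within-suc eq))

countFrom-+ : ∀ P lo a b → countFrom P lo (a + b) ≡ countFrom P lo a + countFrom P (lo + a) b
countFrom-+ P lo zero    b rewrite +-identityʳ lo = refl
countFrom-+ P lo (suc a) b rewrite countFrom-+ P (suc lo) a b | +-suc lo a =
  sym (+-assoc (toℕ (P lo)) _ _)

countFrom-≤ : ∀ P lo len → countFrom P lo len ≤ len
countFrom-≤ P lo zero      = z≤n
countFrom-≤ P lo (suc len) = +-mono-≤ (toℕ≤1 (P lo)) (countFrom-≤ P (suc lo) len)

countFrom-true : ∀ P lo len → Within lo len (λ k → P k ≡ true) → countFrom P lo len ≡ len
countFrom-true P lo zero      h = refl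
countFrom-true P lo (suc len) h
  rewrite h lo ≤-refl (lo<lo+suc lo len) = cong suc (countFrom-true P (suc lo) len (within-suc h))

countFrom-false : ∀ P lo len → Within lo len (λ k → P k ≡ false) → countFrom P lo len ≡ 0
countFrom-false P lo zero      h = refl
countFrom-false P lo (suc len) h
  rewrite h lo ≤-refl (lo<lo+suc lo len) = countFrom-false P (suc lo) len (within-suc h)

1≤countFrom : ∀ P lo len a → lo ≤ a → a < lo + len → P a ≡ true → 1 ≤ countFrom P lo len
1≤countFrom P lo zero      a lo≤a a<end Pa = ⊥-elim (empty-range lo≤a a<end)
1≤countFrom P lo (suc len) a lo≤a a<end Pa with m≤n⇒m<n∨m≡n lo≤a
... | inj₂ refl rewrite Pa = s≤s z≤n
... | inj₁ lo<a = ≤-trans (1≤countFrom P (suc lo) len a lo<a (subst (a <_) (+-suc lo len) a<end) Pa)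
                          (m≤n+m _ (toℕ (P lo)))

countFrom<len : ∀ P lo len a → lo ≤ a → a < lo + len → P a ≡ false → countFrom P lo len < len
countFrom<len P lo zero      a lo≤a a<end Pa = ⊥-elim (empty-range lo≤a a<end)
countFrom<len P lo (suc len) a lo≤a a<end Pa with m≤n⇒m<n∨m≡n lo≤a
... | inj₂ refl rewrite Pa = s≤s (countFrom-≤ P (suc lo) len)
... | inj₁ lo<a = s≤s (≤-trans (+-monoˡ-≤ (countFrom P (suc lo) len) (toℕ≤1 (P lo)))
                               (countFrom<len P (suc lo) len a lo<a (subst (a <_) (+-suc lo len) a<end) Pa))

countFrom-update : ∀ P Q lo len a → lo ≤ a → a < lo + len →
                   Within lo len (λ k → k ≢ a → P k ≡ Q k) →
                   countFrom P lo len + toℕ (Q a) ≡ countFrom Q lo len + toℕ (P a)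
countFrom-update P Q lo zero      a lo≤a a<end eq = ⊥-elim (empty-range lo≤a a<end)
countFrom-update P Q lo (suc len) a lo≤a a<end eq with m≤n⇒m<n∨m≡n lo≤a
... | inj₂ refl
  rewrite countFrom-cong P Q (suc lo) len (λ k lo<k k<end → within-suc eq k lo<k k<end (>⇒≢ lo<k)) =
  swap-ends (toℕ (P lo)) (countFrom Q (suc lo) len) (toℕ (Q lo))
  where
  swap-ends : ∀ a b c → a + b + c ≡ c + b + a
  swap-ends = solve-∀
... | inj₁ lo<a = begin
    toℕ (P lo) + countFrom P (suc lo) len + toℕ (Q a)   ≡⟨ +-assoc (toℕ (P lo)) _ _ ⟩
    toℕ (P lo) + (countFrom P (suc lo) len + toℕ (Q a)) ≡⟨ cong₂ _+_ (cong toℕ Plo≡Qlo) ih ⟩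
    toℕ (Q lo) + (countFrom Q (suc lo) len + toℕ (P a)) ≡⟨ +-assoc (toℕ (Q lo)) _ _ ⟨
    toℕ (Q lo) + countFrom Q (suc lo) len + toℕ (P a)   ∎
  where
  open ≡-Reasoning
  Plo≡Qlo = eq lo ≤-refl (lo<lo+suc lo len) (<⇒≢ lo<a)
  ih = countFrom-update P Q (suc lo) len a lo<a (subst (a <_) (+-suc lo len) a<end) (within-suc eq)

≢⇒≡ᵇ-false : ∀ {m n} → m ≢ n → (m ≡ᵇ n) ≡ false
≢⇒≡ᵇ-false {m} {n} m≢n with m ≡ᵇ n | ≡ᵇ⇒≡ m n
... | true  | m≡n = ⊥-elim (m≢n (m≡n _))
... | false | _   = refl

swap-at-left : ∀ x a b → swap x a b a ≡ x b
swap-at-left x a b with a ≡ᵇ a | ≡⇒≡ᵇ a a refl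
... | true | _ = refl

swap-at-right : ∀ x a b → swap x a b b ≡ x a
swap-at-right x a b with b ≡ᵇ a | ≡ᵇ⇒≡ b a | b ≡ᵇ b | ≡⇒≡ᵇ b b refl
... | true  | b≡a | _    | _ rewrite b≡a _ = refl
... | false | _   | true | _ = refl

swap-elsewhere : ∀ x a b k → k ≢ a → k ≢ b → swap x a b k ≡ x k
swap-elsewhere x a b k k≢a k≢b rewrite ≢⇒≡ᵇ-false k≢a | ≢⇒≡ᵇ-false k≢b = refl

countFrom-swap : ∀ (P : ℕ → Bool) x a b lo len →
                 lo ≤ a → a < lo + len → lo ≤ b → b < lo + len → a ≢ b →
                 countFrom (P ∘ swap x a b) lo len ≡ countFrom (P ∘ x) lo len
countFrom-swap P x a b lo len lo≤a a<end lo≤b b<end a≢b =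
  +-cancelʳ-≡ (toℕ (P (x b))) _ _ (trans swap-vs-update update-vs-x)
  where
  open ≡-Reasoning
  update : Array
  update k = if k ≡ᵇ a then x b else x k
  update-at : update a ≡ x b
  update-at with a ≡ᵇ a | ≡⇒≡ᵇ a a refl
  ... | true | _ = refl
  update-elsewhere : ∀ k → k ≢ a → update k ≡ x k
  update-elsewhere k k≢a rewrite ≢⇒≡ᵇ-false k≢a = refl
  swap-vs-update-elsewhere : ∀ k → k ≢ b → swap x a b k ≡ update k
  swap-vs-update-elsewhere k k≢b with k ≡ᵇ a
  ... | true  = refl
  ... | false rewrite ≢⇒≡ᵇ-false k≢b = refl
  update-vs-x : countFrom (P ∘ update) lo len + toℕ (P (x a)) ≡ countFrom (P ∘ x) lo len + toℕ (P (x b))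
  update-vs-x = begin
    countFrom (P ∘ update) lo len + toℕ (P (x a))
      ≡⟨ countFrom-update (P ∘ update) (P ∘ x) lo len a lo≤a a<end
           (λ k _ _ k≢a → cong P (update-elsewhere k k≢a)) ⟩
    countFrom (P ∘ x) lo len + toℕ (P (update a))
      ≡⟨ cong (λ t → countFrom (P ∘ x) lo len + toℕ (P t)) update-at ⟩
    countFrom (P ∘ x) lo len + toℕ (P (x b)) ∎
  swap-vs-update : countFrom (P ∘ swap x a b) lo len + toℕ (P (x b))
                 ≡ countFrom (P ∘ update) lo len + toℕ (P (x a))
  swap-vs-update = begin
    countFrom (P ∘ swap x a b) lo len + toℕ (P (x b))
      ≡⟨ cong (λ t → countFrom (P ∘ swap x a b) lo len + toℕ (P t)) (update-elsewhere b (a≢b ∘ sym)) ⟨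
    countFrom (P ∘ swap x a b) lo len + toℕ (P (update b))
      ≡⟨ countFrom-update (P ∘ swap x a b) (P ∘ update) lo len b lo≤b b<end
           (λ k _ _ k≢b → cong P (swap-vs-update-elsewhere k k≢b)) ⟩
    countFrom (P ∘ update) lo len + toℕ (P (swap x a b b))
      ≡⟨ cong (λ t → countFrom (P ∘ update) lo len + toℕ (P t)) (swap-at-right x a b) ⟩
    countFrom (P ∘ update) lo len + toℕ (P (x a)) ∎

swap-preserves : ∀ (Q : ℕ → Set) x a b k → Q (x a) → Q (x b) → Q (x k) → Q (swap x a b k)
swap-preserves Q x a b k Qa Qb Qk with k ≡ᵇ a
... | true  = Qb
... | false with k ≡ᵇ b
...   | true  = Qa
...   | false = Qk

-- Partitioning around the pivot

small : ℕ → ℕ → Bool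
small v a = a <ᵇ v

large : ℕ → ℕ → Bool
large v a = not (small v a)

small-true : ∀ {v a} → a < v → small v a ≡ true
small-true {v} {a} a<v with a <ᵇ v | <ᵇ-reflects-< a v
... | true  | _        = refl
... | false | ofⁿ a≮v = ⊥-elim (a≮v a<v)

small-false : ∀ {v a} → v ≤ a → small v a ≡ false
small-false {v} {a} v≤a with a <ᵇ v | <ᵇ-reflects-< a v
... | true  | ofʸ a<v = ⊥-elim (<⇒≱ a<v v≤a)
... | false | _       = refl

module Partition (v m : ℕ) where

  -- large keys in the block 2 .. s + 1 that the s small keys finally occupy
  misplaced : ℕ → Array → ℕ
  misplaced s x = countFrom (large v ∘ x) 2 s

  record Keys (s : ℕ) (x : Array) : Set where
    field
      ≢pivot : ∀ k → 2 ≤ k → k ≤ suc m → x k ≢ v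
      smalls : countFrom (small v ∘ x) 2 m ≡ s
      -- position 1 holds v, or a small key once step A1 has exchanged x₁ and x_n
      x₁≤v   : x 1 ≤ v

  record Scanned (x : Array) (a b : ℕ) : Set where
    field
      below : ∀ k → 2 ≤ k → k < a → x k < v
      above : ∀ k → b ≤ k → k ≤ suc m → v < x k

  open Keys
  open Scanned

  nothing-scanned : ∀ {x} → Scanned x 2 (suc (suc m))
  nothing-scanned = record
    { below = λ k 2≤k k<2 → ⊥-elim (<⇒≱ k<2 2≤k)
    ; above = λ k 2+m≤k k≤1+m → ⊥-elim (<⇒≱ 2+m≤k k≤1+m)
    }

  scanned-small : ∀ {x a b} → Scanned x a b → x a < v → Scanned x (suc a) b
  scanned-small {x} {a} sc xa<v = record { below = below′ ; above = above sc }
    where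
    below′ : ∀ k → 2 ≤ k → k < suc a → x k < v
    below′ k 2≤k k≤a with m≤n⇒m<n∨m≡n (≤-pred k≤a)
    ... | inj₁ k<a  = below sc k 2≤k k<a
    ... | inj₂ refl = xa<v

  scanned-large : ∀ {x a b} → Scanned x a (suc b) → v < x b → Scanned x a b
  scanned-large {x} {a} {b} sc v<xb = record { below = below sc ; above = above′ }
    where
    above′ : ∀ k → b ≤ k → k ≤ suc m → v < x k
    above′ k b≤k k≤ with m≤n⇒m<n∨m≡n b≤k
    ... | inj₁ b<k  = above sc k b<k k≤
    ... | inj₂ refl = v<xb

  partitioned⇒misplaced≡0 : ∀ {s x t} → Keys s x → Scanned x t t → 2 ≤ t → t ≤ suc (suc m) →
                            misplaced s x ≡ 0
  partitioned⇒misplaced≡0 {s} {x} {suc (suc a)} keys sc (s≤s (s≤s z≤n)) t≤ =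
    trans (cong (λ r → misplaced r x) s≡a)
          (countFrom-false (large v ∘ x) 2 a (λ k 2≤k k<t → cong not (small-true (below sc k 2≤k k<t))))
    where
    open ≡-Reasoning
    a+rest≡m : a + (m ∸ a) ≡ m
    a+rest≡m = m+[n∸m]≡n (≤-pred (≤-pred t≤))
    s≡a : s ≡ a
    s≡a = begin
      s                                    ≡⟨ smalls keys ⟨
      countFrom (small v ∘ x) 2 m           ≡⟨ cong (countFrom (small v ∘ x) 2) a+rest≡m ⟨
      countFrom (small v ∘ x) 2 (a + (m ∸ a)) ≡⟨ countFrom-+ (small v ∘ x) 2 a (m ∸ a) ⟩
      countFrom (small v ∘ x) 2 a + countFrom (small v ∘ x) (2 + a) (m ∸ a)
        ≡⟨ cong₂ _+_ (countFrom-true (small v ∘ x) 2 a (λ k 2≤k k<t → small-true (below sc k 2≤k k<t)))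
                     (countFrom-false (small v ∘ x) (2 + a) (m ∸ a)
                       (λ k t≤k k<end → small-false (<⇒≤ (above sc k t≤k
                          (≤-pred (subst (λ r → k < 2 + r) a+rest≡m k<end)))))) ⟩
      a + 0                                ≡⟨ +-identityʳ a ⟩
      a                                    ∎

  swap-keys : ∀ {s x i j} → Keys s x → 2 ≤ i → i < j → j ≤ suc m → Keys s (swap x i j)
  swap-keys {x = x} {i} {j} kx 2≤i i<j j≤ = record
    { ≢pivot = λ k 2≤k k≤ → swap-preserves (_≢ v) x i j k
                              (≢pivot kx i 2≤i i≤) (≢pivot kx j 2≤j j≤) (≢pivot kx k 2≤k k≤)
    ; smalls = trans (countFrom-swap (small v) x i j 2 m 2≤i (s≤s i≤) 2≤j (s≤s j≤) (<⇒≢ i<j)) (smalls kx)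
    ; x₁≤v   = subst (_≤ v) (sym (swap-elsewhere x i j 1 (<⇒≢ 2≤i) (<⇒≢ 2≤j))) (x₁≤v kx)
    }
    where
    i≤ : i ≤ suc m
    i≤ = <⇒≤ (<-≤-trans i<j j≤)
    2≤j : 2 ≤ j
    2≤j = ≤-trans 2≤i (<⇒≤ i<j)

  swap-scanned : ∀ {x i j} → Scanned x i (suc j) → i < j → v < x i → x j < v →
                 Scanned (swap x i j) (suc i) j
  swap-scanned {x} {i} {j} sc i<j xi-large xj-small = record { below = below′ ; above = above′ }
    where
    below′ : ∀ k → 2 ≤ k → k < suc i → swap x i j k < v
    below′ k 2≤k k≤i with m≤n⇒m<n∨m≡n (≤-pred k≤i)
    ... | inj₂ refl = subst (_< v) (sym (swap-at-left x i j)) xj-small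
    ... | inj₁ k<i  = subst (_< v) (sym (swap-elsewhere x i j k (<⇒≢ k<i) (<⇒≢ (<-trans k<i i<j))))
                              (below sc k 2≤k k<i)
    above′ : ∀ k → j ≤ k → k ≤ suc m → v < swap x i j k
    above′ k j≤k k≤ with m≤n⇒m<n∨m≡n j≤k
    ... | inj₂ refl = subst (v <_) (sym (swap-at-right x i j)) xi-large
    ... | inj₁ j<k  = subst (v <_) (sym (swap-elsewhere x i j k (>⇒≢ (<-trans i<j j<k)) (>⇒≢ j<k)))
                              (above sc k j<k k≤)

  -- x j is a small key to the right of the i - 2 small keys at 2 .. i - 1
  i<boundary : ∀ {s x i j} → Keys s x → Scanned x i (suc j) → 2 ≤ i → i < j → j ≤ suc m →
               x j < v → i < 2 + s
  i<boundary {s} {x} {i@(suc (suc a))} {j} kx sc (s≤s (s≤s z≤n)) i<j j≤ xj-small = s≤s (s≤s (begin-strict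
    a                                               ≡⟨ +-identityʳ a ⟨
    a + 0                                           <⟨ +-monoʳ-< a (1≤countFrom (small v ∘ x) i (m ∸ a) j (<⇒≤ i<j)
                                                                      (subst (λ r → j < 2 + r) (sym a+rest≡m) (s≤s j≤))
                                                                      (small-true xj-small)) ⟩
    a + countFrom (small v ∘ x) i (m ∸ a)           ≡⟨ cong (_+ countFrom (small v ∘ x) i (m ∸ a))
                                                            (countFrom-true (small v ∘ x) 2 a before-i) ⟨
    countFrom (small v ∘ x) 2 a + countFrom (small v ∘ x) i (m ∸ a)
                                                    ≡⟨ countFrom-+ (small v ∘ x) 2 a (m ∸ a) ⟨
    countFrom (small v ∘ x) 2 (a + (m ∸ a))         ≡⟨ cong (countFrom (small v ∘ x) 2) a+rest≡m ⟩
    countFrom (small v ∘ x) 2 m                     ≡⟨ smalls kx ⟩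
    s                                               ∎))
    where
    open ≤-Reasoning
    a+rest≡m : a + (m ∸ a) ≡ m
    a+rest≡m = m+[n∸m]≡n (≤-trans (n≤1+n a) (≤-pred (<⇒≤ (<-≤-trans i<j j≤))))
    before-i : Within 2 a (λ k → small v (x k) ≡ true)
    before-i k 2≤k k<i = small-true (below sc k 2≤k k<i)

  -- x i is a large key to the left of the small key x j, and every key right of j is large
  boundary≤j : ∀ {s x i j} → Keys s x → Scanned x i (suc j) → 2 ≤ i → i < j → j ≤ suc m →
               v < x i → x j < v → 2 + s ≤ j
  boundary≤j {s} {x} {i} {j@(suc (suc b))} kx sc 2≤i i<j j≤ xi-large xj-small = s≤s (s≤s (begin
    s                                               ≡⟨ smalls kx ⟨
    countFrom (small v ∘ x) 2 m                     ≡⟨ cong (countFrom (small v ∘ x) 2) b+rest≡m ⟨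
    countFrom (small v ∘ x) 2 (b + suc (m ∸ suc b)) ≡⟨ countFrom-+ (small v ∘ x) 2 b (suc (m ∸ suc b)) ⟩
    countFrom (small v ∘ x) 2 b + (toℕ (small v (x j)) + countFrom (small v ∘ x) (suc j) (m ∸ suc b))
                                                    ≡⟨ cong (λ r → countFrom (small v ∘ x) 2 b + r)
                                                            (cong₂ _+_ (cong toℕ (small-true xj-small))
                                                               (countFrom-false (small v ∘ x) (suc j) (m ∸ suc b) beyond-j)) ⟩
    countFrom (small v ∘ x) 2 b + 1                 ≡⟨ +-comm _ 1 ⟩
    suc (countFrom (small v ∘ x) 2 b)               ≤⟨ countFrom<len (small v ∘ x) 2 b i 2≤i i<j
                                                            (small-false (<⇒≤ xi-large)) ⟩
    b                                               ∎))
    where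
    open ≤-Reasoning
    b+rest≡m : b + suc (m ∸ suc b) ≡ m
    b+rest≡m = trans (+-suc b _) (m+[n∸m]≡n (≤-pred j≤))
    beyond-j : Within (suc j) (m ∸ suc b) (λ k → small v (x k) ≡ false)
    beyond-j k j<k k<end = small-false (<⇒≤ (above sc k j<k
      (≤-pred (subst (λ r → k < 2 + r) b+rest≡m (subst (k <_) (sym (+-suc (2 + b) _)) k<end)))))
  boundary≤j {i = suc (suc _)} {j = suc zero} _ _ (s≤s (s≤s z≤n)) (s≤s ()) _ _ _

  swap-misplaced : ∀ {s x i j} → 2 ≤ i → i < 2 + s → 2 + s ≤ j → v < x i → x j < v →
                   suc (misplaced s (swap x i j)) ≡ misplaced s x
  swap-misplaced {s} {x} {i} {j} 2≤i i<2+s 2+s≤j xi-large xj-small = begin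
    suc (misplaced s (swap x i j))                   ≡⟨ +-comm 1 _ ⟩
    misplaced s (swap x i j) + 1                     ≡⟨ cong (λ b → misplaced s (swap x i j) + toℕ (not b))
                                                             (small-false (<⇒≤ xi-large)) ⟨
    misplaced s (swap x i j) + toℕ (large v (x i))   ≡⟨ countFrom-update (large v ∘ x) (large v ∘ swap x i j) 2 s i
                                                          2≤i i<2+s only-i-changes ⟨
    misplaced s x + toℕ (large v (swap x i j i))     ≡⟨ cong (λ y → misplaced s x + toℕ (large v y)) (swap-at-left x i j) ⟩
    misplaced s x + toℕ (large v (x j))              ≡⟨ cong (λ b → misplaced s x + toℕ (not b)) (small-true xj-small) ⟩
    misplaced s x + 0                                ≡⟨ +-identityʳ _ ⟩
    misplaced s x                                    ∎
    where
    open ≡-Reasoning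
    only-i-changes : Within 2 s (λ k → k ≢ i → large v (x k) ≡ large v (swap x i j k))
    only-i-changes k _ k<2+s k≢i = cong (large v) (sym (swap-elsewhere x i j k k≢i (<⇒≢ (<-≤-trans k<2+s 2+s≤j))))

  record Exchanged (s : ℕ) (x : Array) (i j : ℕ) : Set where
    field
      keys      : Keys s (swap x i j)
      scanned   : Scanned (swap x i j) (suc i) j
      decreases : suc (misplaced s (swap x i j)) ≡ misplaced s x

  exchange : ∀ {s x i j} → Keys s x → Scanned x i (suc j) → 2 ≤ i → i < j → j ≤ suc m →
             v < x i → x j < v → Exchanged s x i j
  exchange kx sc 2≤i i<j j≤ xi-large xj-small = record
    { keys      = swap-keys kx 2≤i i<j j≤
    ; scanned   = swap-scanned sc i<j xi-large xj-small
    ; decreases = swap-misplaced 2≤i (i<boundary kx sc 2≤i i<j j≤ xj-small)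
                                 (boundary≤j kx sc 2≤i i<j j≤ xi-large xj-small) xi-large xj-small
    }

  after-exchange : ∀ {s x i j} c → Exchanged s x i j → suc c + misplaced s (swap x i j) ≡ c + misplaced s x
  after-exchange c ex = trans (sym (+-suc c _)) (cong (λ r → c + r) (Exchanged.decreases ex))

  finished : ∀ {s x} c → misplaced s x ≡ 0 → c ≡ c + misplaced s x
  finished c none = sym (trans (cong (λ r → c + r) none) (+-identityʳ c))

  -- Scheme B

  record AtB2 (s f : ℕ) (x : Array) (i j : ℕ) : Set where
    field
      keys    : Keys s x
      scanned : Scanned x (suc i) j
      1≤i     : 1 ≤ i
      i<j     : i < j
      j≤      : j ≤ suc (suc m)
      fuel-ok : j < f + i

  record AtB3 (s f : ℕ) (x : Array) (i j : ℕ) : Set where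
    field
      keys    : Keys s x
      scanned : Scanned x i j
      2≤i     : 2 ≤ i
      i≤j     : i ≤ j
      j≤      : j ≤ suc (suc m)
      stop-i  : i ≤ suc m → v < x i
      fuel-ok : j < f + i

  record AtB4 (s f : ℕ) (x : Array) (i j : ℕ) : Set where
    field
      keys    : Keys s x
      scanned : Scanned x i (suc j)
      2≤i     : 2 ≤ i
      i≤1+j   : i ≤ suc j
      j≤      : j ≤ suc m
      stop-i  : i ≤ suc m → v < x i
      stop-j  : x j ≤ v
      fuel-ok : j < f + i

  j-scan-stops : ∀ (x : Array) {i} → 2 ≤ i → (∀ k → 2 ≤ k → k < i → x k < v) → x 1 ≤ v →
                 ¬ (v < x (i ∸ 1))
  j-scan-stops x {suc zero}          (s≤s ())
  j-scan-stops x {suc (suc zero)}    _ _     x₁≤v v<x₁ = <⇒≱ v<x₁ x₁≤v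
  j-scan-stops x {suc (suc (suc i))} _ below _    v<x  = <-asym v<x (below (suc (suc i)) (s≤s (s≤s z≤n)) ≤-refl)

  mutual
    stepB2-misplaced : ∀ {s} f x i j c → AtB2 s f x i j → stepB2 (suc m) f v x i j c ≡ c + misplaced s x
    stepB2-misplaced zero    x i j c st = ⊥-elim (<-asym (AtB2.i<j st) (AtB2.fuel-ok st))
    stepB2-misplaced (suc f) x i j c st
      with i <ᵇ suc m | <ᵇ-reflects-< i (suc m) | x (suc i) <ᵇ v | <ᵇ-reflects-< (x (suc i)) v
    ... | true  | ofʸ i<1+m | true  | ofʸ xi<v = stepB2-misplaced f x (suc i) j c record
      { keys    = keys
      ; scanned = scanned-small scanned xi<v
      ; 1≤i     = s≤s z≤n
      ; i<j     = 1+i<j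
      ; j≤      = j≤
      ; fuel-ok = subst (j <_) (sym (+-suc f i)) fuel-ok
      }
      where
      open AtB2 st
      1+i<j : suc i < j
      1+i<j with suc i <? j
      ... | yes 1+i<j = 1+i<j
      ... | no  1+i≮j = ⊥-elim (<-asym xi<v (above scanned (suc i) (≮⇒≥ 1+i≮j) i<1+m))
    ... | true  | ofʸ i<1+m | false | ofⁿ xi≮v = stepB3-misplaced f x (suc i) j c record
      { keys    = keys
      ; scanned = scanned
      ; 2≤i     = s≤s 1≤i
      ; i≤j     = i<j
      ; j≤      = j≤
      ; stop-i  = λ _ → ≤∧≢⇒< (≮⇒≥ xi≮v) (≢pivot keys (suc i) (s≤s 1≤i) i<1+m ∘ sym)
      ; fuel-ok = subst (j <_) (sym (+-suc f i)) fuel-ok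
      }
      where open AtB2 st
    ... | false | ofⁿ i≮1+m | _     | _ = stepB3-misplaced f x (suc i) j c record
      { keys    = keys
      ; scanned = scanned
      ; 2≤i     = s≤s 1≤i
      ; i≤j     = i<j
      ; j≤      = j≤
      ; stop-i  = λ 1+i≤1+m → ⊥-elim (i≮1+m 1+i≤1+m)
      ; fuel-ok = subst (j <_) (sym (+-suc f i)) fuel-ok
      }
      where open AtB2 st

    stepB3-misplaced : ∀ {s} f x i j c → AtB3 s f x i j → stepB3 (suc m) f v x i j c ≡ c + misplaced s x
    stepB3-misplaced zero    x i j       c st = ⊥-elim (<⇒≱ (AtB3.fuel-ok st) (AtB3.i≤j st))
    stepB3-misplaced (suc f) x i zero    c st = ⊥-elim (<⇒≱ (≤-trans (AtB3.2≤i st) (AtB3.i≤j st)) z≤n)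
    stepB3-misplaced (suc f) x i (suc j) c st with v <ᵇ x j | <ᵇ-reflects-< v (x j)
    ... | true  | ofʸ v<xj = stepB3-misplaced f x i j c record
      { keys    = keys
      ; scanned = scanned-large scanned v<xj
      ; 2≤i     = 2≤i
      ; i≤j     = i≤j′
      ; j≤      = ≤-trans (n≤1+n j) j≤
      ; stop-i  = stop-i
      ; fuel-ok = ≤-pred fuel-ok
      }
      where
      open AtB3 st
      i≤j′ : i ≤ j
      i≤j′ with m≤n⇒m<n∨m≡n i≤j
      ... | inj₁ i<1+j = ≤-pred i<1+j
      ... | inj₂ refl  = ⊥-elim (j-scan-stops x 2≤i (below scanned) (x₁≤v keys) v<xj)
    ... | false | ofⁿ v≮xj = stepB4-misplaced f x i j c record
      { keys    = keys
      ; scanned = scanned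
      ; 2≤i     = 2≤i
      ; i≤1+j   = i≤j
      ; j≤      = ≤-pred j≤
      ; stop-i  = stop-i
      ; stop-j  = ≮⇒≥ v≮xj
      ; fuel-ok = ≤-pred fuel-ok
      }
      where open AtB3 st

    stepB4-misplaced : ∀ {s} f x i j c → AtB4 s f x i j → stepB4 (suc m) f v x i j c ≡ c + misplaced s x
    stepB4-misplaced {s} f x i j c st with i <ᵇ j | <ᵇ-reflects-< i j
    ... | true  | ofʸ i<j = trans (stepB2-misplaced f (swap x i j) i j (suc c) record
      { keys    = Exchanged.keys ex
      ; scanned = Exchanged.scanned ex
      ; 1≤i     = ≤-trans (s≤s z≤n) 2≤i
      ; i<j     = i<j
      ; j≤      = ≤-trans j≤ (n≤1+n _)
      ; fuel-ok = fuel-ok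
      }) (after-exchange c ex)
      where
      open AtB4 st
      ex = exchange keys scanned 2≤i i<j j≤ (stop-i (≤-trans (<⇒≤ i<j) j≤))
             (≤∧≢⇒< stop-j (≢pivot keys j (≤-trans 2≤i (<⇒≤ i<j)) j≤))
    ... | false | ofⁿ i≮j with m≤n⇒m<n∨m≡n (≮⇒≥ i≮j)
    ...   | inj₁ j<i with refl ← ≤-antisym (AtB4.i≤1+j st) j<i =
      finished {s} {x} c (partitioned⇒misplaced≡0 keys scanned 2≤i (s≤s j≤))
      where open AtB4 st
    ...   | inj₂ refl = ⊥-elim (<⇒≱ (stop-i j≤) stop-j)
      where open AtB4 st

  stepB2-misplaced-initially : ∀ {s} f x c → Keys s x → suc m < f →
                               stepB2 (suc m) f v x 1 (suc (suc m)) c ≡ c + misplaced s x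
  stepB2-misplaced-initially f x c keys 1+m<f = stepB2-misplaced f x 1 (suc (suc m)) c record
    { keys    = keys
    ; scanned = nothing-scanned
    ; 1≤i     = ≤-refl
    ; i<j     = s≤s (s≤s z≤n)
    ; j≤      = ≤-refl
    ; fuel-ok = subst (suc (suc m) <_) (+-comm 1 _) (s≤s 1+m<f)
    }

  -- Scheme C

  record AtC2 (s f : ℕ) (x : Array) (i j : ℕ) : Set where
    field
      keys    : Keys s x
      scanned : Scanned x i (suc j)
      2≤i     : 2 ≤ i
      i≤1+j   : i ≤ suc j
      j≤      : j ≤ suc m
      fuel-ok : 3 + j ≤ f + i

  record AtC3 (s f : ℕ) (x : Array) (i j : ℕ) : Set where
    field
      keys    : Keys s x
      scanned : Scanned x i (suc j)
      2≤i     : 2 ≤ i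
      i≤1+j   : i ≤ suc j
      j≤      : j ≤ suc m
      stop-i  : i ≤ j → v < x i
      fuel-ok : 2 + j ≤ f + i

  mutual
    stepC2-misplaced : ∀ {s} f x i j c → AtC2 s f x i j → stepC2 f v x i j c ≡ c + misplaced s x
    stepC2-misplaced zero    x i j c st = ⊥-elim (<⇒≱ (AtC2.fuel-ok st) (≤-trans (AtC2.i≤1+j st) (n≤1+n _)))
    stepC2-misplaced (suc f) x i j c st
      with i <ᵇ suc j | <ᵇ-reflects-< i (suc j) | x i <ᵇ v | <ᵇ-reflects-< (x i) v
    ... | true  | ofʸ i≤j | true  | ofʸ xi<v = stepC2-misplaced f x (suc i) j c record
      { keys    = keys
      ; scanned = scanned-small scanned xi<v
      ; 2≤i     = ≤-trans 2≤i (n≤1+n i)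
      ; i≤1+j   = i≤j
      ; j≤      = j≤
      ; fuel-ok = subst (3 + j ≤_) (sym (+-suc f i)) fuel-ok
      }
      where open AtC2 st
    ... | true  | ofʸ i≤j | false | ofⁿ xi≮v = stepC3-misplaced f x i j c record
      { keys    = keys
      ; scanned = scanned
      ; 2≤i     = 2≤i
      ; i≤1+j   = i≤1+j
      ; j≤      = j≤
      ; stop-i  = λ _ → ≤∧≢⇒< (≮⇒≥ xi≮v) (≢pivot keys i 2≤i (≤-trans (≤-pred i≤j) j≤) ∘ sym)
      ; fuel-ok = ≤-pred fuel-ok
      }
      where open AtC2 st
    ... | false | ofⁿ i≰j | _     | _ = stepC3-misplaced f x i j c record
      { keys    = keys
      ; scanned = scanned
      ; 2≤i     = 2≤i
      ; i≤1+j   = i≤1+j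
      ; j≤      = j≤
      ; stop-i  = λ i≤j → ⊥-elim (i≰j (s≤s i≤j))
      ; fuel-ok = ≤-pred fuel-ok
      }
      where open AtC2 st

    stepC3-misplaced : ∀ {s} f x i j c → AtC3 s f x i j → stepC3 f v x i j c ≡ c + misplaced s x
    stepC3-misplaced zero    x i j    c st = ⊥-elim (<⇒≱ (AtC3.fuel-ok st) (AtC3.i≤1+j st))
    stepC3-misplaced (suc f) x i zero c st = ⊥-elim (<⇒≱ (≤-trans (AtC3.2≤i st) (AtC3.i≤1+j st)) ≤-refl)
    stepC3-misplaced {s} (suc f) x i (suc j) c st
      with i <ᵇ suc j | <ᵇ-reflects-< i (suc j) | v <ᵇ x (suc j) | <ᵇ-reflects-< v (x (suc j))
         | j <ᵇ i     | <ᵇ-reflects-< j i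
    ... | true  | ofʸ i<1+j | true  | ofʸ v<xj | _     | _ = stepC3-misplaced f x i j c record
      { keys    = keys
      ; scanned = scanned-large scanned v<xj
      ; 2≤i     = 2≤i
      ; i≤1+j   = <⇒≤ i<1+j
      ; j≤      = ≤-trans (n≤1+n j) j≤
      ; stop-i  = λ i≤j → stop-i (≤-trans i≤j (n≤1+n j))
      ; fuel-ok = ≤-pred fuel-ok
      }
      where open AtC3 st
    ... | true  | ofʸ i<1+j | false | ofⁿ v≮xj | true  | ofʸ j<i = ⊥-elim (<⇒≱ j<i (≤-pred i<1+j))
    ... | true  | ofʸ i<1+j | false | ofⁿ v≮xj | false | _ =
      trans (stepC2-misplaced f (swap x i (suc j)) (suc i) j (suc c) record
        { keys    = Exchanged.keys ex
        ; scanned = Exchanged.scanned ex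
        ; 2≤i     = ≤-trans 2≤i (n≤1+n i)
        ; i≤1+j   = i<1+j
        ; j≤      = ≤-trans (n≤1+n j) j≤
        ; fuel-ok = subst (3 + j ≤_) (sym (+-suc f i)) fuel-ok
        }) (after-exchange c ex)
      where
      open AtC3 st
      ex = exchange keys scanned 2≤i i<1+j j≤ (stop-i (<⇒≤ i<1+j))
             (≤∧≢⇒< (≮⇒≥ v≮xj) (≢pivot keys (suc j) (≤-trans 2≤i (<⇒≤ i<1+j)) j≤))
    ... | false | ofⁿ i≰j | _ | _ | true  | ofʸ j<i with m≤n⇒m<n∨m≡n (≮⇒≥ i≰j)
    ...   | inj₁ 1+j<i with refl ← ≤-antisym (AtC3.i≤1+j st) 1+j<i =
      finished {s} {x} c (partitioned⇒misplaced≡0 keys scanned 2≤i (s≤s j≤))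
      where open AtC3 st
    ...   | inj₂ refl =
      finished {s} {x} c (partitioned⇒misplaced≡0 keys (scanned-large scanned (stop-i ≤-refl)) 2≤i
                                                  (≤-trans j≤ (n≤1+n _)))
      where open AtC3 st
    stepC3-misplaced {s} (suc f) x i (suc j) c st
        | false | ofⁿ i≰j | _ | _ | false | ofⁿ j≮i = ⊥-elim (j≮i (≮⇒≥ i≰j))

  stepC2-misplaced-initially : ∀ {s} f x c → Keys s x → suc m < f →
                               stepC2 f v x 2 (suc m) c ≡ c + misplaced s x
  stepC2-misplaced-initially f x c keys 1+m<f = stepC2-misplaced f x 2 (suc m) c record
    { keys    = keys
    ; scanned = nothing-scanned
    ; 2≤i     = ≤-refl
    ; i≤1+j   = s≤s (s≤s z≤n)
    ; j≤      = ≤-refl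
    ; fuel-ok = subst (4 + m ≤_) (+-comm 2 f) (+-monoʳ-≤ 2 1+m<f)
    }

  -- Scheme A runs Scheme B on the keys at 2 .. suc m as long as the last position holds no small key

  mutual
    stepA2≡stepB2 : ∀ f x i j c → i ≤ suc m → j ≤ suc (suc m) → v ≤ x (suc (suc m)) →
                    stepA2 f v x i j c ≡ stepB2 (suc m) f v x i j c
    stepA2≡stepB2 zero    x i j c i≤ j≤ sentinel = refl
    stepA2≡stepB2 (suc f) x i j c i≤ j≤ sentinel
      with i <ᵇ suc m | <ᵇ-reflects-< i (suc m) | x (suc i) <ᵇ v | <ᵇ-reflects-< (x (suc i)) v
    ... | true  | ofʸ i<1+m | true  | _        = stepA2≡stepB2 f x (suc i) j c i<1+m j≤ sentinel
    ... | false | ofⁿ i≮1+m | true  | ofʸ xi<v with refl ← ≤-antisym i≤ (≮⇒≥ i≮1+m) =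
      ⊥-elim (<⇒≱ xi<v sentinel)
    ... | true  | _         | false | _        = stepA3≡stepB3 f x (suc i) j c j≤ sentinel
    ... | false | _         | false | _        = stepA3≡stepB3 f x (suc i) j c j≤ sentinel

    stepA3≡stepB3 : ∀ f x i j c → j ≤ suc (suc m) → v ≤ x (suc (suc m)) →
                    stepA3 f v x i j c ≡ stepB3 (suc m) f v x i j c
    stepA3≡stepB3 zero    x i j c j≤ sentinel = refl
    stepA3≡stepB3 (suc f) x i j c j≤ sentinel with v <ᵇ x (j ∸ 1)
    ... | true  = stepA3≡stepB3 f x i (j ∸ 1) c (≤-trans (m∸n≤m j 1) j≤) sentinel
    ... | false = stepA4≡stepB4 f x i (j ∸ 1) c (∸-monoˡ-≤ 1 j≤) sentinel

    stepA4≡stepB4 : ∀ f x i j c → j ≤ suc m → v ≤ x (suc (suc m)) →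
                    stepA4 f v x i j c ≡ stepB4 (suc m) f v x i j c
    stepA4≡stepB4 f x i j c j≤ sentinel with i <ᵇ j | <ᵇ-reflects-< i j
    ... | true  | ofʸ i<j =
      stepA2≡stepB2 f (swap x i j) i j (suc c) (<⇒≤ (<-≤-trans i<j j≤)) (≤-trans j≤ (n≤1+n _))
                    (subst (v ≤_) (sym (swap-elsewhere x i j (suc (suc m)) n≢i n≢j)) sentinel)
      where
      n≢j : suc (suc m) ≢ j
      n≢j = >⇒≢ (s≤s j≤)
      n≢i : suc (suc m) ≢ i
      n≢i = >⇒≢ (<-≤-trans i<j (≤-trans j≤ (n≤1+n _)))
    ... | false | _       = refl

  keys-cong : ∀ {s x y} → Keys s x → (∀ k → 2 ≤ k → k ≤ suc m → y k ≡ x k) → y 1 ≤ v → Keys s y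
  keys-cong {x = x} {y} kx y≗x y₁≤v = record
    { ≢pivot = λ k 2≤k k≤ → subst (_≢ v) (sym (y≗x k 2≤k k≤)) (≢pivot kx k 2≤k k≤)
    ; smalls = trans (countFrom-cong (small v ∘ y) (small v ∘ x) 2 m
                        (λ k 2≤k k< → cong (small v) (y≗x k 2≤k (≤-pred k<))))
                     (smalls kx)
    ; x₁≤v   = y₁≤v
    }

  misplaced-cong : ∀ {s x y} → s ≤ m → (∀ k → 2 ≤ k → k ≤ suc m → y k ≡ x k) →
                   misplaced s y ≡ misplaced s x
  misplaced-cong {s} s≤m y≗x =
    countFrom-cong _ _ 2 s (λ k 2≤k k<2+s → cong (large v) (y≗x k 2≤k (≤-pred (≤-trans k<2+s (s≤s (s≤s s≤m))))))

  smalls≤m : ∀ {s x} → Keys s x → s ≤ m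
  smalls≤m {x = x} kx = subst (_≤ m) (smalls kx) (countFrom-≤ (small v ∘ x) 2 m)

n<fuel : ∀ n → n < fuel n
n<fuel n = ≤-trans (subst (suc n ≤_) (+-comm 2 n) (n≤1+n (suc n)))
                   (m≤m*n (n + 2) (n + 2) {{subst NonZero (+-comm 2 n) _}})

module _ (m : ℕ) (x : Array) {s : ℕ} where
  open Partition (x 1) m

  swapsB-misplaced : Keys s x → swapsB (suc m) x ≡ misplaced s x
  swapsB-misplaced kx = stepB2-misplaced-initially (fuel (suc m)) x 0 kx (n<fuel (suc m))

  swapsC-misplaced : Keys s x → swapsC (suc m) x ≡ misplaced s x
  swapsC-misplaced kx = stepC2-misplaced-initially (fuel (suc m)) x 0 kx (n<fuel (suc m))

  swapsA-misplaced : Keys s x → swapsA (suc (suc m)) x ≡ toℕ (small (x 1) (x (suc (suc m)))) + misplaced s x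
  swapsA-misplaced kx with x (suc (suc m)) <ᵇ x 1 | <ᵇ-reflects-< (x (suc (suc m))) (x 1)
  ... | true  | ofʸ xn<v = begin
    stepA2 f v (swap x 1 n) 1 n 1           ≡⟨ stepA2≡stepB2 f (swap x 1 n) 1 n 1 (s≤s z≤n) ≤-refl
                                                 (subst (v ≤_) (sym (swap-at-right x 1 n)) ≤-refl) ⟩
    stepB2 (suc m) f v (swap x 1 n) 1 n 1   ≡⟨ stepB2-misplaced-initially f (swap x 1 n) 1
                                                 (keys-cong kx unchanged
                                                   (subst (_≤ v) (sym (swap-at-left x 1 n)) (<⇒≤ xn<v)))
                                                 (<-trans (n<1+n (suc m)) (n<fuel n)) ⟩
    1 + misplaced s (swap x 1 n)            ≡⟨ cong suc (misplaced-cong (smalls≤m kx) unchanged) ⟩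
    1 + misplaced s x                       ∎
    where
    open ≡-Reasoning
    n = suc (suc m)
    f = fuel n
    v = x 1
    unchanged : ∀ k → 2 ≤ k → k ≤ suc m → swap x 1 n k ≡ x k
    unchanged k 2≤k k≤ = swap-elsewhere x 1 n k (>⇒≢ 2≤k) (<⇒≢ (s≤s k≤))
  ... | false | ofⁿ xn≮v = trans (stepA2≡stepB2 f x 1 n 0 (s≤s z≤n) ≤-refl (≮⇒≥ xn≮v))
                                 (stepB2-misplaced-initially f x 0 kx (<-trans (n<1+n (suc m)) (n<fuel n)))
    where
    n = suc (suc m)
    f = fuel n

-- Scheme D

stepD-smalls : ∀ n v f x i p c r → i + r ≡ suc n → p < i → r ≤ f →
               stepD n f v x i p c ≡ c + countFrom (small v ∘ x) i r
stepD-smalls n v zero    x i p c zero    _    _   _ = sym (+-identityʳ c)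
stepD-smalls n v (suc f) x i p c zero    i+0≡ _   _ with n <ᵇ i | <ᵇ-reflects-< n i
... | true  | _       = sym (+-identityʳ c)
... | false | ofⁿ n≮i = ⊥-elim (n≮i (subst (n <_) (sym (trans (sym (+-identityʳ i)) i+0≡)) ≤-refl))
stepD-smalls n v (suc f) x i p c (suc r) i+r≡ p<i (s≤s r≤f) with n <ᵇ i | <ᵇ-reflects-< n i
... | true  | ofʸ n<i = ⊥-elim (<⇒≱ n<i (≤-pred (subst (suc i ≤_) i+r≡′ (s≤s (m≤m+n i r)))))
  where
  i+r≡′ : suc (i + r) ≡ suc n
  i+r≡′ = trans (sym (+-suc i r)) i+r≡
... | false | _ with x i <ᵇ v
...   | true  = begin
  stepD n f v (swap x (suc p) i) (suc i) (suc p) (suc c)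
    ≡⟨ stepD-smalls n v f (swap x (suc p) i) (suc i) (suc p) (suc c) r (trans (sym (+-suc i r)) i+r≡) (s≤s p<i) r≤f ⟩
  suc c + countFrom (small v ∘ swap x (suc p) i) (suc i) r
    ≡⟨ cong (λ t → suc c + t) (countFrom-cong _ _ (suc i) r
         (λ k i<k _ → cong (small v) (swap-elsewhere x (suc p) i k (>⇒≢ (<-≤-trans (s≤s p<i) i<k)) (>⇒≢ i<k)))) ⟩
  suc c + countFrom (small v ∘ x) (suc i) r
    ≡⟨ +-suc c _ ⟨
  c + suc (countFrom (small v ∘ x) (suc i) r) ∎
  where open ≡-Reasoning
...   | false = stepD-smalls n v f x (suc i) p c r (trans (sym (+-suc i r)) i+r≡) (≤-trans p<i (n≤1+n i)) r≤f

swapsD-smalls : ∀ m x → swapsD (suc m) x ≡ countFrom (small (x 1) ∘ x) 2 m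
swapsD-smalls m x =
  stepD-smalls (suc m) (x 1) (fuel (suc m)) x 2 1 0 m refl ≤-refl (≤-trans (n≤1+n m) (<⇒≤ (n<fuel (suc m))))

count : {A : Set} → (A → Bool) → List A → ℕ
count P xs = sum (map (toℕ ∘ P) xs)

count-↭ : ∀ {A : Set} (P : A → Bool) {xs ys} → xs ↭ ys → count P xs ≡ count P ys
count-↭ P xs↭ys = sum-↭ (↭-map⁺ (toℕ ∘ P) xs↭ys)

count-complement : ∀ {A : Set} (P : A → Bool) xs → count P xs + count (not ∘ P) xs ≡ length xs
count-complement P []       = refl
count-complement P (x ∷ xs) with P x
... | true  = cong suc (count-complement P xs)
... | false = trans (+-suc (count P xs) _) (cong suc (count-complement P xs))

count-≤-length : ∀ {A : Set} (P : A → Bool) xs → count P xs ≤ length xs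
count-≤-length P xs = subst (count P xs ≤_) (count-complement P xs) (m≤m+n _ _)

count-take-≤ : ∀ {A : Set} (P : A → Bool) t xs → count P (take t xs) ≤ count P xs
count-take-≤ P zero    xs       = z≤n
count-take-≤ P (suc t) []       = z≤n
count-take-≤ P (suc t) (x ∷ xs) = +-monoʳ-≤ (toℕ (P x)) (count-take-≤ P t xs)

count-take-length : ∀ {A : Set} (P : A → Bool) xs → count P (take (length xs) xs) ≡ count P xs
count-take-length P xs = cong (count P) (take-all (length xs) xs ≤-refl)

lastIs : {A : Set} → (A → Bool) → List A → Bool
lastIs P []           = false
lastIs P (x ∷ [])     = P x
lastIs P (x ∷ y ∷ ys) = lastIs P (y ∷ ys)

count-init-last : ∀ {A : Set} (P : A → Bool) xs m → length xs ≡ suc m →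
                  count P xs ≡ count P (take m xs) + toℕ (lastIs P xs)
count-init-last P (x ∷ [])     zero    _   = +-comm (toℕ (P x)) 0
count-init-last P (x ∷ y ∷ ys) (suc m) len =
  trans (cong (λ r → toℕ (P x) + r) (count-init-last P (y ∷ ys) m (suc-injective len)))
        (sym (+-assoc (toℕ (P x)) _ _))

length-filter-<? : ∀ v ks → length (filter (_<? v) ks) ≡ count (small v) ks
length-filter-<? v []       = refl
length-filter-<? v (k ∷ ks) with k <ᵇ v
... | true  = cong suc (length-filter-<? v ks)
... | false = length-filter-<? v ks

countFrom-toArr-∷ : ∀ (P : ℕ → Bool) v y ys lo t →
                    countFrom (P ∘ toArr v (y ∷ ys)) (3 + lo) t ≡ countFrom (P ∘ toArr v ys) (2 + lo) t
countFrom-toArr-∷ P v y ys lo zero    = refl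
countFrom-toArr-∷ P v y ys lo (suc t) =
  cong (λ r → toℕ (P (toArr v ys (2 + lo))) + r) (countFrom-toArr-∷ P v y ys (suc lo) t)

countFrom-toArr : ∀ (P : ℕ → Bool) v p t → t ≤ length p →
                  countFrom (P ∘ toArr v p) 2 t ≡ count P (take t p)
countFrom-toArr P v p        zero    _       = refl
countFrom-toArr P v (y ∷ ys) (suc t) (s≤s t≤) =
  cong (λ r → toℕ (P y) + r) (trans (countFrom-toArr-∷ P v y ys 0 t) (countFrom-toArr P v ys t t≤))

toArr-last : ∀ (P : ℕ → Bool) v p m → length p ≡ suc m → P (toArr v p (suc (suc m))) ≡ lastIs P p
toArr-last P v (y ∷ [])     zero    _   = refl
toArr-last P v (y ∷ z ∷ zs) (suc m) len = toArr-last P v (z ∷ zs) m (suc-injective len)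

All-toArr : ∀ {Q : ℕ → Set} v p → All Q p → ∀ k → 2 ≤ k → k ≤ suc (length p) → Q (toArr v p k)
All-toArr v p        _          (suc zero)          (s≤s ())
All-toArr v []       []         (suc (suc zero))    _ (s≤s ())
All-toArr v (y ∷ ys) (Qy ∷ _)   (suc (suc zero))    _ _        = Qy
All-toArr v (y ∷ ys) (_ ∷ Qys) (suc (suc (suc k))) _ (s≤s k≤) =
  All-toArr v ys Qys (suc (suc k)) (s≤s (s≤s z≤n)) k≤

keys-toArr : ∀ v p m → m ≤ length p → All (v ≢_) p →
             Partition.Keys v m (count (small v) (take m p)) (toArr v p)
keys-toArr v p m m≤ v∉p = record
  { ≢pivot = λ k 2≤k k≤ → All-toArr v p (All.map (_∘ sym) v∉p) k 2≤k (≤-trans k≤ (s≤s m≤))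
  ; smalls = countFrom-toArr (small v) v p m m≤
  ; x₁≤v   = ≤-refl
  }

swapsD-toArr : ∀ v p m → length p ≡ m → swapsD (suc m) (toArr v p) ≡ count (small v) p
swapsD-toArr v p .(length p) refl =
  trans (swapsD-smalls (length p) (toArr v p))
        (trans (countFrom-toArr (small v) v p (length p) ≤-refl) (count-take-length (small v) p))

module _ (v : ℕ) (p : List ℕ) (v∉p : All (v ≢_) p) where

  private
    keys : ∀ m → m ≤ length p → Partition.Keys v m (count (small v) (take m p)) (toArr v p)
    keys m m≤ = keys-toArr v p m m≤ v∉p

    misplaced-toArr : ∀ m → m ≤ length p →
                      Partition.misplaced v m (count (small v) (take m p)) (toArr v p)
                      ≡ count (large v) (take (count (small v) (take m p)) p)
    misplaced-toArr m m≤ = countFrom-toArr (large v) v p _ (≤-trans (Partition.smalls≤m v m (keys m m≤)) m≤)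

    misplaced-all : Partition.misplaced v (length p) (count (small v) (take (length p) p)) (toArr v p)
                    ≡ count (large v) (take (count (small v) p) p)
    misplaced-all = trans (misplaced-toArr (length p) ≤-refl)
                          (cong (λ s → count (large v) (take s p)) (count-take-length (small v) p))

  swapsB-toArr : ∀ m → length p ≡ m → swapsB (suc m) (toArr v p) ≡ count (large v) (take (count (small v) p) p)
  swapsB-toArr .(length p) refl =
    trans (swapsB-misplaced (length p) (toArr v p) (keys (length p) ≤-refl)) misplaced-all

  swapsC-toArr : ∀ m → length p ≡ m → swapsC (suc m) (toArr v p) ≡ count (large v) (take (count (small v) p) p)
  swapsC-toArr .(length p) refl =
    trans (swapsC-misplaced (length p) (toArr v p) (keys (length p) ≤-refl)) misplaced-all

  swapsA-toArr : ∀ m → length p ≡ suc m →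
                 let b = toℕ (lastIs (small v) p) in
                 swapsA (suc (suc m)) (toArr v p) ≡ b + count (large v) (take (count (small v) p ∸ b) p)
  swapsA-toArr m len = begin
    swapsA (suc (suc m)) (toArr v p)
      ≡⟨ swapsA-misplaced m (toArr v p) (keys m m≤) ⟩
    toℕ (small v (toArr v p (suc (suc m)))) + Partition.misplaced v m s (toArr v p)
      ≡⟨ cong₂ _+_ (cong toℕ (toArr-last (small v) v p m len)) (misplaced-toArr m m≤) ⟩
    b + count (large v) (take s p)
      ≡⟨ cong (λ r → b + count (large v) (take r p)) s≡ ⟩
    b + count (large v) (take (count (small v) p ∸ b) p) ∎
    where
    open ≡-Reasoning
    b = toℕ (lastIs (small v) p)
    s = count (small v) (take m p)
    m≤ : m ≤ length p
    m≤ = subst (m ≤_) (sym len) (n≤1+n m)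
    s≡ : s ≡ count (small v) p ∸ b
    s≡ = sym (trans (cong (_∸ b) (count-init-last (small v) p m len)) (m+n∸n≡m s b))

-- Sums over arrangements

module _ {A : Set} where

  sum-map-cong : ∀ {f g : A → ℕ} {xs} → All (λ a → f a ≡ g a) xs → sum (map f xs) ≡ sum (map g xs)
  sum-map-cong eqs = cong sum (map-cong-local eqs)

  sum-map-+ : ∀ (f g : A → ℕ) xs → sum (map (λ a → f a + g a) xs) ≡ sum (map f xs) + sum (map g xs)
  sum-map-+ f g []       = refl
  sum-map-+ f g (x ∷ xs) rewrite sum-map-+ f g xs = +-exchange (f x) (g x) _ _
    where
    +-exchange : ∀ a b c d → a + b + (c + d) ≡ a + c + (b + d)
    +-exchange = solve-∀

  sum-map-*ˡ : ∀ c (f : A → ℕ) xs → sum (map (λ a → c * f a) xs) ≡ c * sum (map f xs)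
  sum-map-*ˡ c f []       = sym (*-zeroʳ c)
  sum-map-*ˡ c f (x ∷ xs) rewrite sum-map-*ˡ c f xs = sym (*-distribˡ-+ c (f x) _)

  sum-map-const : ∀ c (xs : List A) → sum (map (λ _ → c) xs) ≡ length xs * c
  sum-map-const c []       = refl
  sum-map-const c (x ∷ xs) = cong (λ r → c + r) (sum-map-const c xs)

  sum-map-0 : ∀ {f : A → ℕ} xs → (∀ a → f a ≡ 0) → sum (map f xs) ≡ 0
  sum-map-0 {f} xs f≗0 = trans (cong sum (map-cong f≗0 xs)) (trans (sum-map-const 0 xs) (*-zeroʳ (length xs)))

  sum-map-map : ∀ {B : Set} (f : B → ℕ) (g : A → B) xs → sum (map f (map g xs)) ≡ sum (map (f ∘ g) xs)
  sum-map-map f g xs = cong sum (sym (map-∘ xs))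

  sum-map-concatMap : ∀ {B : Set} (f : B → ℕ) (g : A → List B) xs →
                      sum (map f (concatMap g xs)) ≡ sum (map (λ a → sum (map f (g a))) xs)
  sum-map-concatMap f g []       = refl
  sum-map-concatMap f g (x ∷ xs) = begin
    sum (map f (g x ++ concatMap g xs))               ≡⟨ cong sum (map-++ f (g x) _) ⟩
    sum (map f (g x) ++ map f (concatMap g xs))       ≡⟨ sum-++ (map f (g x)) _ ⟩
    sum (map f (g x)) + sum (map f (concatMap g xs))  ≡⟨ cong (λ r → sum (map f (g x)) + r)
                                                               (sum-map-concatMap f g xs) ⟩
    sum (map f (g x)) + sum (map (λ a → sum (map f (g a))) xs) ∎
    where open ≡-Reasoning

  length-concatMap : ∀ {B : Set} (g : A → List B) xs → length (concatMap g xs) ≡ sum (map (length ∘ g) xs)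
  length-concatMap g []       = refl
  length-concatMap g (x ∷ xs) =
    trans (length-++ (g x)) (cong (λ r → length (g x) + r) (length-concatMap g xs))

module _ {A : Set} where

  insertAll-↭ : ∀ (e : A) r → All (_↭ e ∷ r) (insertAll e r)
  insertAll-↭ e []       = ↭.refl ∷ []
  insertAll-↭ e (y ∷ ys) =
    ↭.refl ∷ All.map⁺ (All.map (λ p↭ → ↭.trans (↭.prep y p↭) (↭.swap y e ↭.refl)) (insertAll-↭ e ys))

  insertAll-nonempty : ∀ (e : A) r → All (λ p → 1 ≤ length p) (insertAll e r)
  insertAll-nonempty e r = All.map (λ p↭ → subst (1 ≤_) (sym (↭-length p↭)) (s≤s z≤n)) (insertAll-↭ e r)

  arrangements-↭ : ∀ (xs : List A) → All (_↭ xs) (arrangements xs)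
  arrangements-↭ []      = ↭.refl ∷ []
  arrangements-↭ (e ∷ q) = All.concat⁺ (All.map⁺ (All.map insert-↭ (arrangements-↭ q)))
    where
    insert-↭ : ∀ {r} → r ↭ q → All (_↭ e ∷ q) (insertAll e r)
    insert-↭ {r} r↭q = All.map (λ p↭ → ↭.trans p↭ (↭.prep e r↭q)) (insertAll-↭ e r)

  length-insertAll : ∀ (e : A) r → length (insertAll e r) ≡ suc (length r)
  length-insertAll e []       = refl
  length-insertAll e (y ∷ ys) = cong suc (trans (length-map (y ∷_) (insertAll e ys)) (length-insertAll e ys))

  length-arrangements : ∀ (xs : List A) → length (arrangements xs) ≡ length xs !
  length-arrangements []      = refl
  length-arrangements (e ∷ q) = begin
    length (concatMap (insertAll e) (arrangements q))           ≡⟨ length-concatMap (insertAll e) (arrangements q) ⟩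
    sum (map (length ∘ insertAll e) (arrangements q))           ≡⟨ sum-map-cong (All.map length-insert (arrangements-↭ q)) ⟩
    sum (map (λ _ → suc (length q)) (arrangements q))           ≡⟨ sum-map-const (suc (length q)) (arrangements q) ⟩
    length (arrangements q) * suc (length q)                    ≡⟨ cong (_* suc (length q)) (length-arrangements q) ⟩
    length q ! * suc (length q)                                 ≡⟨ *-comm (length q !) _ ⟩
    suc (length q) !                                            ∎
    where
    open ≡-Reasoning
    length-insert : ∀ {r} → r ↭ q → length (insertAll e r) ≡ suc (length q)
    length-insert {r} r↭q = trans (length-insertAll e r) (cong suc (↭-length r↭q))

module _ {A : Set} (Q : A → Bool) where

  private
    T : ℕ → List A → ℕ
    T t p = count Q (take t p)

  sum-count-take-insertAll : ∀ e r t d → length r ≡ t + d →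
    sum (map (T (suc t)) (insertAll e r)) ≡ suc t * (toℕ (Q e) + T t r) + d * T (suc t) r
  sum-count-take-insertAll e []       zero    zero _   = sym (+-identityʳ _)
  sum-count-take-insertAll e (y ∷ ys) zero    d    len = begin
    toℕ (Q e) + 0 + sum (map (T 1) (map (y ∷_) (insertAll e ys)))
      ≡⟨ cong (λ r → toℕ (Q e) + 0 + r) (trans (sum-map-map (T 1) (y ∷_) (insertAll e ys))
                                               (sum-map-const (toℕ (Q y) + 0) (insertAll e ys))) ⟩
    toℕ (Q e) + 0 + length (insertAll e ys) * (toℕ (Q y) + 0)
      ≡⟨ cong (λ l → toℕ (Q e) + 0 + l * (toℕ (Q y) + 0)) (trans (length-insertAll e ys) len) ⟩
    toℕ (Q e) + 0 + d * (toℕ (Q y) + 0)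
      ≡⟨ cong (_+ d * (toℕ (Q y) + 0)) (sym (*-identityˡ _)) ⟩
    1 * (toℕ (Q e) + 0) + d * (toℕ (Q y) + 0) ∎
    where open ≡-Reasoning
  sum-count-take-insertAll e (y ∷ ys) (suc t) d len = begin
    toℕ (Q e) + (toℕ (Q y) + T t ys) + sum (map (T (2 + t)) (map (y ∷_) (insertAll e ys)))
      ≡⟨ cong (λ r → toℕ (Q e) + (toℕ (Q y) + T t ys) + r)
              (trans (sum-map-map (T (2 + t)) (y ∷_) (insertAll e ys))
                     (sum-map-+ (λ _ → toℕ (Q y)) (T (suc t)) (insertAll e ys))) ⟩
    toℕ (Q e) + (toℕ (Q y) + T t ys)
      + (sum (map (λ _ → toℕ (Q y)) (insertAll e ys)) + sum (map (T (suc t)) (insertAll e ys)))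
      ≡⟨ cong₂ (λ a b → toℕ (Q e) + (toℕ (Q y) + T t ys) + (a + b))
               (trans (sum-map-const (toℕ (Q y)) (insertAll e ys))
                      (cong (_* toℕ (Q y)) (trans (length-insertAll e ys) len)))
               (sum-count-take-insertAll e ys t d (suc-injective len)) ⟩
    toℕ (Q e) + (toℕ (Q y) + T t ys) + (suc (t + d) * toℕ (Q y) + (suc t * (toℕ (Q e) + T t ys) + d * T (suc t) ys))
      ≡⟨ regroup (toℕ (Q e)) (toℕ (Q y)) (T t ys) (T (suc t) ys) t d ⟩
    suc (suc t) * (toℕ (Q e) + (toℕ (Q y) + T t ys)) + d * (toℕ (Q y) + T (suc t) ys) ∎
    where
    open ≡-Reasoning
    regroup : ∀ qe qy a b t d → qe + (qy + a) + (suc (t + d) * qy + (suc t * (qe + a) + d * b)) ≡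
                                suc (suc t) * (qe + (qy + a)) + d * (qy + b)
    regroup = solve-∀

  sum-count-take-arrangements-∷ : ∀ e q t d → length q ≡ t + d →
    sum (map (T (suc t)) (arrangements (e ∷ q)))
    ≡ suc t * (length q ! * toℕ (Q e) + sum (map (T t) (arrangements q))) + d * sum (map (T (suc t)) (arrangements q))
  sum-count-take-arrangements-∷ e q t d len = begin
    sum (map (T (suc t)) (concatMap (insertAll e) arrs))
      ≡⟨ sum-map-concatMap (T (suc t)) (insertAll e) arrs ⟩
    sum (map (λ r → sum (map (T (suc t)) (insertAll e r))) arrs)
      ≡⟨ sum-map-cong (All.map (λ r↭q → sum-count-take-insertAll e _ t d (trans (↭-length r↭q) len))
                               (arrangements-↭ q)) ⟩
    sum (map (λ r → suc t * (toℕ (Q e) + T t r) + d * T (suc t) r) arrs)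
      ≡⟨ trans (sum-map-+ _ _ arrs)
               (cong₂ _+_ (trans (sum-map-*ˡ (suc t) _ arrs) (cong (suc t *_) (sum-map-+ _ _ arrs))) (sum-map-*ˡ d _ arrs)) ⟩
    suc t * (sum (map (λ _ → toℕ (Q e)) arrs) + sum (map (T t) arrs)) + d * sum (map (T (suc t)) arrs)
      ≡⟨ cong (λ a → suc t * (a + sum (map (T t) arrs)) + d * sum (map (T (suc t)) arrs))
              (trans (sum-map-const _ arrs) (cong (_* toℕ (Q e)) (length-arrangements q))) ⟩
    suc t * (length q ! * toℕ (Q e) + sum (map (T t) arrs)) + d * sum (map (T (suc t)) arrs) ∎
    where
    open ≡-Reasoning
    arrs = arrangements q

  sum-count-take : ∀ q k t → length q ≡ suc k → t ≤ suc k → sum (map (T t) (arrangements q)) ≡ t * count Q q * k !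
  sum-count-take q        k       zero          _   _     = sum-map-0 (arrangements q) (λ _ → refl)
  sum-count-take (e ∷ []) zero    (suc zero)    _   _     = sym (*-identityʳ _)
  sum-count-take (e ∷ []) zero    (suc (suc t)) _   (s≤s ())
  sum-count-take (e ∷ q)  (suc k) (suc t)       len 1+t≤ with d , t+d≡ ← m≤n⇒∃[o]m+o≡n (≤-pred 1+t≤) = begin
    sum (map (T (suc t)) (arrangements (e ∷ q)))
      ≡⟨ sum-count-take-arrangements-∷ e q t d (trans lenq (sym t+d≡)) ⟩
    suc t * (length q ! * toℕ (Q e) + ΣT t) + d * ΣT (suc t)
      ≡⟨ cong₂ (λ a b → suc t * (a * toℕ (Q e) + b) + d * ΣT (suc t))
               (cong _! lenq) (sum-count-take q k t lenq (≤-pred 1+t≤)) ⟩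
    suc t * (suc k * k ! * toℕ (Q e) + t * cQ * k !) + d * ΣT (suc t)
      ≡⟨ cong (λ c → suc t * (suc k * k ! * toℕ (Q e) + t * cQ * k !) + c) (d*ΣT d t+d≡) ⟩
    suc t * (suc k * k ! * toℕ (Q e) + t * cQ * k !) + d * (suc t * cQ * k !)
      ≡⟨ cong (λ l → suc t * (l * k ! * toℕ (Q e) + t * cQ * k !) + d * (suc t * cQ * k !)) t+d≡ ⟨
    suc t * ((t + d) * k ! * toℕ (Q e) + t * cQ * k !) + d * (suc t * cQ * k !)
      ≡⟨ regroup t d (toℕ (Q e)) cQ (k !) ⟩
    suc t * (toℕ (Q e) + cQ) * ((t + d) * k !)
      ≡⟨ cong (λ l → suc t * (toℕ (Q e) + cQ) * (l * k !)) t+d≡ ⟩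
    suc t * (toℕ (Q e) + cQ) * (suc k * k !) ∎
    where
    open ≡-Reasoning
    cQ = count Q q
    ΣT : ℕ → ℕ
    ΣT t = sum (map (T t) (arrangements q))
    lenq : length q ≡ suc k
    lenq = suc-injective len
    -- the induction hypothesis for suc t is only available, and only needed, when d > 0
    d*ΣT : ∀ d → t + d ≡ suc k → d * ΣT (suc t) ≡ d * (suc t * cQ * k !)
    d*ΣT zero     _    = refl
    d*ΣT (suc d′) t+d≡ = cong (suc d′ *_) (sum-count-take q k (suc t) lenq
                                             (subst (suc t ≤_) (trans (sym (+-suc t d′)) t+d≡) (s≤s (m≤m+n t d′))))
    regroup : ∀ t d qe c K → suc t * ((t + d) * K * qe + t * c * K) + d * (suc t * c * K) ≡ suc t * (qe + c) * ((t + d) * K)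
    regroup = solve-∀

lastIs-∷ : ∀ {A : Set} (P : A → Bool) y p → 1 ≤ length p → lastIs P (y ∷ p) ≡ lastIs P p
lastIs-∷ P y (a ∷ as) _ = refl

module _ {A : Set} (P : A → Bool) where

  private
    L : List A → ℕ
    L p = toℕ (lastIs P p)

  -- inserting e at the end makes e the last entry; any other position keeps the last entry of y ∷ ys
  sum-lastIs-insertAll : ∀ e y ys → sum (map L (insertAll e (y ∷ ys))) ≡ toℕ (P e) + suc (length ys) * L (y ∷ ys)
  sum-lastIs-insertAll e y []       = regroup (toℕ (P e)) (toℕ (P y))
    where
    regroup : ∀ pe py → py + (pe + 0) ≡ pe + 1 * py
    regroup = solve-∀
  sum-lastIs-insertAll e y (z ∷ zs) = begin
    L (z ∷ zs) + sum (map L (map (y ∷_) (insertAll e (z ∷ zs))))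
      ≡⟨ cong (λ r → L (z ∷ zs) + r) (trans (sum-map-map L (y ∷_) (insertAll e (z ∷ zs)))
           (sum-map-cong (All.map (λ {p} 1≤ → cong toℕ (lastIs-∷ P y p 1≤)) (insertAll-nonempty e (z ∷ zs))))) ⟩
    L (z ∷ zs) + sum (map L (insertAll e (z ∷ zs)))
      ≡⟨ cong (λ r → L (z ∷ zs) + r) (sum-lastIs-insertAll e z zs) ⟩
    L (z ∷ zs) + (toℕ (P e) + suc (length zs) * L (z ∷ zs))
      ≡⟨ regroup (L (z ∷ zs)) (toℕ (P e)) (length zs) ⟩
    toℕ (P e) + suc (suc (length zs)) * L (z ∷ zs) ∎
    where
    open ≡-Reasoning
    regroup : ∀ l pe n → l + (pe + suc n * l) ≡ pe + suc (suc n) * l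
    regroup = solve-∀

  sum-lastIs : ∀ q k → length q ≡ suc k → sum (map L (arrangements q)) ≡ count P q * k !
  sum-lastIs (e ∷ [])     zero    _   = sym (*-identityʳ _)
  sum-lastIs (e ∷ y ∷ ys) (suc k) len = begin
    sum (map L (concatMap (insertAll e) arrs))
      ≡⟨ sum-map-concatMap L (insertAll e) arrs ⟩
    sum (map (λ r → sum (map L (insertAll e r))) arrs)
      ≡⟨ sum-map-cong (All.map (λ {r} r↭ → insert-last r (↭-length r↭)) (arrangements-↭ (y ∷ ys))) ⟩
    sum (map (λ r → toℕ (P e) + suc k * L r) arrs)
      ≡⟨ trans (sum-map-+ _ _ arrs) (cong₂ _+_ (sum-map-const _ arrs) (sum-map-*ˡ (suc k) L arrs)) ⟩
    length arrs * toℕ (P e) + suc k * sum (map L arrs)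
      ≡⟨ cong₂ (λ a b → a * toℕ (P e) + suc k * b) (trans (length-arrangements (y ∷ ys)) (cong _! len′))
                                                   (sum-lastIs (y ∷ ys) k len′) ⟩
    suc k ! * toℕ (P e) + suc k * (count P (y ∷ ys) * k !)
      ≡⟨ regroup (toℕ (P e)) (count P (y ∷ ys)) k (k !) ⟩
    (toℕ (P e) + count P (y ∷ ys)) * suc k ! ∎
    where
    open ≡-Reasoning
    arrs = arrangements (y ∷ ys)
    len′ : length (y ∷ ys) ≡ suc k
    len′ = suc-injective len
    insert-last : ∀ r → length r ≡ length (y ∷ ys) → sum (map L (insertAll e r)) ≡ toℕ (P e) + suc k * L r
    insert-last (z ∷ zs) lenr =
      trans (sum-lastIs-insertAll e z zs) (cong (λ l → toℕ (P e) + l * L (z ∷ zs)) (trans lenr len′))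
    regroup : ∀ pe c k K → (K + k * K) * pe + suc k * (c * K) ≡ (pe + c) * (K + k * K)
    regroup = solve-∀

toℕ-∧ : ∀ a b → toℕ (a ∧ b) ≡ toℕ a * toℕ b
toℕ-∧ false b = refl
toℕ-∧ true  b = sym (+-identityʳ (toℕ b))

module _ {A : Set} (P Q : A → Bool) where

  private
    L : List A → ℕ
    L p = toℕ (lastIs P p)
    T : ℕ → List A → ℕ
    T t p = count Q (take t p)
    G : ℕ → List A → ℕ
    G t p = L p * T t p

  sum-G-∷ : ∀ y t ps → All (λ p → 1 ≤ length p) ps →
            sum (map (G (suc t)) (map (y ∷_) ps)) ≡ toℕ (Q y) * sum (map L ps) + sum (map (G t) ps)
  sum-G-∷ y t ps nonempty = begin
    sum (map (G (suc t)) (map (y ∷_) ps))                    ≡⟨ sum-map-map (G (suc t)) (y ∷_) ps ⟩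
    sum (map (λ p → G (suc t) (y ∷ p)) ps)                    ≡⟨ sum-map-cong (All.map (λ {p} → G-∷ {p}) nonempty) ⟩
    sum (map (λ p → L p * toℕ (Q y) + G t p) ps)              ≡⟨ sum-map-+ (λ p → L p * toℕ (Q y)) (G t) ps ⟩
    sum (map (λ p → L p * toℕ (Q y)) ps) + sum (map (G t) ps) ≡⟨ cong (_+ sum (map (G t) ps)) L*Qy ⟩
    toℕ (Q y) * sum (map L ps) + sum (map (G t) ps)           ∎
    where
    open ≡-Reasoning
    G-∷ : ∀ {p} → 1 ≤ length p → G (suc t) (y ∷ p) ≡ L p * toℕ (Q y) + G t p
    G-∷ {p} 1≤ = trans (cong (λ b → toℕ b * T (suc t) (y ∷ p)) (lastIs-∷ P y p 1≤))
                       (*-distribˡ-+ (L p) (toℕ (Q y)) (T t p))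
    L*Qy : sum (map (λ p → L p * toℕ (Q y)) ps) ≡ toℕ (Q y) * sum (map L ps)
    L*Qy = trans (cong sum (map-cong (λ p → *-comm (L p) (toℕ (Q y))) ps)) (sum-map-*ˡ (toℕ (Q y)) L ps)

  sum-G-insertAll : ∀ e r t d → length r ≡ suc (t + d) →
    sum (map (G (suc t)) (insertAll e r)) ≡ suc t * (L r * (toℕ (Q e) + T t r)) + d * G (suc t) r + toℕ (P e) * T (suc t) r
  sum-G-insertAll e (y ∷ [])     zero    zero _   = regroup (toℕ (P y)) (toℕ (Q e)) (toℕ (P e)) (toℕ (Q y))
    where
    regroup : ∀ py qe pe qy → py * (qe + 0) + (pe * (qy + 0) + 0) ≡ 1 * (py * (qe + 0)) + 0 + pe * (qy + 0)
    regroup = solve-∀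
  sum-G-insertAll e (y ∷ z ∷ zs) zero    d    len = begin
    B * (toℕ (Q e) + 0) + sum (map (G 1) (map (y ∷_) (insertAll e (z ∷ zs))))
      ≡⟨ cong (λ r → B * (toℕ (Q e) + 0) + r)
              (trans (sum-G-∷ y 0 (insertAll e (z ∷ zs)) (insertAll-nonempty e (z ∷ zs)))
                     (cong₂ _+_ (cong (toℕ (Q y) *_) (sum-lastIs-insertAll P e z zs))
                                (sum-map-0 (insertAll e (z ∷ zs)) (λ p → *-zeroʳ (L p))))) ⟩
    B * (toℕ (Q e) + 0) + (toℕ (Q y) * (toℕ (P e) + suc (length zs) * B) + 0)
      ≡⟨ cong (λ l → B * (toℕ (Q e) + 0) + (toℕ (Q y) * (toℕ (P e) + l * B) + 0)) (suc-injective len) ⟩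
    B * (toℕ (Q e) + 0) + (toℕ (Q y) * (toℕ (P e) + d * B) + 0)
      ≡⟨ regroup B (toℕ (Q e)) (toℕ (Q y)) (toℕ (P e)) d ⟩
    1 * (B * (toℕ (Q e) + 0)) + d * (B * (toℕ (Q y) + 0)) + toℕ (P e) * (toℕ (Q y) + 0) ∎
    where
    open ≡-Reasoning
    B = L (z ∷ zs)
    regroup : ∀ b qe qy pe d → b * (qe + 0) + (qy * (pe + d * b) + 0) ≡
                               1 * (b * (qe + 0)) + d * (b * (qy + 0)) + pe * (qy + 0)
    regroup = solve-∀
  sum-G-insertAll e (y ∷ z ∷ zs) (suc t) d    len = begin
    B * (toℕ (Q e) + (toℕ (Q y) + X)) + sum (map (G (2 + t)) (map (y ∷_) (insertAll e (z ∷ zs))))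
      ≡⟨ cong (λ r → B * (toℕ (Q e) + (toℕ (Q y) + X)) + r)
              (trans (sum-G-∷ y (suc t) (insertAll e (z ∷ zs)) (insertAll-nonempty e (z ∷ zs)))
                     (cong₂ _+_ (cong (toℕ (Q y) *_) (sum-lastIs-insertAll P e z zs))
                                (sum-G-insertAll e (z ∷ zs) t d (suc-injective len)))) ⟩
    B * (toℕ (Q e) + (toℕ (Q y) + X)) + (toℕ (Q y) * (toℕ (P e) + suc (length zs) * B)
                                          + (suc t * (B * (toℕ (Q e) + X)) + d * (B * Y) + toℕ (P e) * Y))
      ≡⟨ cong (λ l → B * (toℕ (Q e) + (toℕ (Q y) + X)) + (toℕ (Q y) * (toℕ (P e) + suc l * B)
                                          + (suc t * (B * (toℕ (Q e) + X)) + d * (B * Y) + toℕ (P e) * Y)))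
              (suc-injective (suc-injective len)) ⟩
    B * (toℕ (Q e) + (toℕ (Q y) + X)) + (toℕ (Q y) * (toℕ (P e) + suc (t + d) * B)
                                          + (suc t * (B * (toℕ (Q e) + X)) + d * (B * Y) + toℕ (P e) * Y))
      ≡⟨ regroup B (toℕ (Q e)) (toℕ (Q y)) (toℕ (P e)) X Y t d ⟩
    suc (suc t) * (B * (toℕ (Q e) + (toℕ (Q y) + X))) + d * (B * (toℕ (Q y) + Y)) + toℕ (P e) * (toℕ (Q y) + Y) ∎
    where
    open ≡-Reasoning
    B = L (z ∷ zs)
    X = T t (z ∷ zs)
    Y = T (suc t) (z ∷ zs)
    regroup : ∀ b qe qy pe x y t d →
      b * (qe + (qy + x)) + (qy * (pe + suc (t + d) * b) + (suc t * (b * (qe + x)) + d * (b * y) + pe * y)) ≡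
      suc (suc t) * (b * (qe + (qy + x))) + d * (b * (qy + y)) + pe * (qy + y)
    regroup = solve-∀

  sum-G-arrangements-∷ : ∀ e q t d → length q ≡ suc (t + d) →
    sum (map (G (suc t)) (arrangements (e ∷ q)))
    ≡ suc t * (toℕ (Q e) * sum (map L (arrangements q)) + sum (map (G t) (arrangements q)))
      + d * sum (map (G (suc t)) (arrangements q)) + toℕ (P e) * sum (map (T (suc t)) (arrangements q))
  sum-G-arrangements-∷ e q t d len = begin
    sum (map (G (suc t)) (concatMap (insertAll e) arrs))
      ≡⟨ sum-map-concatMap (G (suc t)) (insertAll e) arrs ⟩
    sum (map (λ r → sum (map (G (suc t)) (insertAll e r))) arrs)
      ≡⟨ sum-map-cong (All.map insert (arrangements-↭ q)) ⟩
    sum (map (λ r → suc t * (toℕ (Q e) * L r + G t r) + d * G (suc t) r + toℕ (P e) * T (suc t) r) arrs)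
      ≡⟨ trans (sum-map-+ _ _ arrs) (cong (_+ _) (sum-map-+ _ _ arrs)) ⟩
    sum (map (λ r → suc t * (toℕ (Q e) * L r + G t r)) arrs) + sum (map (λ r → d * G (suc t) r) arrs)
      + sum (map (λ r → toℕ (P e) * T (suc t) r) arrs)
      ≡⟨ cong₂ _+_ (cong₂ _+_ (trans (sum-map-*ˡ (suc t) _ arrs)
                                     (cong (suc t *_) (trans (sum-map-+ _ _ arrs) (cong (_+ _) (sum-map-*ˡ (toℕ (Q e)) L arrs)))))
                              (sum-map-*ˡ d (G (suc t)) arrs))
                   (sum-map-*ˡ (toℕ (P e)) (T (suc t)) arrs) ⟩
    suc t * (toℕ (Q e) * sum (map L arrs) + sum (map (G t) arrs))
      + d * sum (map (G (suc t)) arrs) + toℕ (P e) * sum (map (T (suc t)) arrs) ∎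
    where
    open ≡-Reasoning
    arrs = arrangements q
    insert : ∀ {r} → r ↭ q → sum (map (G (suc t)) (insertAll e r))
                             ≡ suc t * (toℕ (Q e) * L r + G t r) + d * G (suc t) r + toℕ (P e) * T (suc t) r
    insert {r} r↭q = trans (sum-G-insertAll e r t d (trans (↭-length r↭q) len))
                           (cong (λ a → suc t * a + d * G (suc t) r + toℕ (P e) * T (suc t) r)
                                 (trans (*-distribˡ-+ (L r) (toℕ (Q e)) (T t r)) (cong (_+ G t r) (*-comm (L r) (toℕ (Q e))))))

  sum-lastIs*count-take : (∀ a → P a ∧ Q a ≡ false) → ∀ q k t → length q ≡ suc (suc k) → t ≤ suc k →
                          sum (map (G t) (arrangements q)) ≡ t * count P q * count Q q * k !
  sum-lastIs*count-take disjoint q k zero _ _ = sum-map-0 (arrangements q) (λ p → *-zeroʳ (L p))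
  sum-lastIs*count-take disjoint (e ∷ y ∷ []) zero (suc zero) _ _ =
    sym (trans (expand (toℕ (P e)) (toℕ (P y)) (toℕ (Q e)) (toℕ (Q y)))
               (trans (cong₂ (λ a b → toℕ (P y) * (toℕ (Q e) + 0) + (toℕ (P e) * (toℕ (Q y) + 0) + 0) + (a + b))
                             (disjoint* e) (disjoint* y))
                      (+-identityʳ _)))
    where
    disjoint* : ∀ a → toℕ (P a) * toℕ (Q a) ≡ 0
    disjoint* a = trans (sym (toℕ-∧ (P a) (Q a))) (cong toℕ (disjoint a))
    expand : ∀ pe py qe qy → 1 * (pe + (py + 0)) * (qe + (qy + 0)) * 1
                             ≡ py * (qe + 0) + (pe * (qy + 0) + 0) + (pe * qe + py * qy)
    expand = solve-∀
  sum-lastIs*count-take disjoint (e ∷ y ∷ []) zero (suc (suc t)) _ (s≤s ())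
  sum-lastIs*count-take disjoint (e ∷ q) (suc k) (suc t) len 1+t≤
    with d , t+d≡ ← m≤n⇒∃[o]m+o≡n (≤-pred 1+t≤) = begin
    sum (map (G (suc t)) (arrangements (e ∷ q)))
      ≡⟨ sum-G-arrangements-∷ e q t d (trans lenq (cong suc (sym t+d≡))) ⟩
    suc t * (toℕ (Q e) * sum (map L (arrangements q)) + ΣG t) + d * ΣG (suc t) + toℕ (P e) * ΣT
      ≡⟨ cong₂ (λ a b → suc t * (toℕ (Q e) * a + b) + d * ΣG (suc t) + toℕ (P e) * ΣT)
               (sum-lastIs P q (suc k) lenq) (sum-lastIs*count-take disjoint q k t lenq (≤-pred 1+t≤)) ⟩
    suc t * (toℕ (Q e) * (cP * (suc k * k !)) + t * cP * cQ * k !) + d * ΣG (suc t) + toℕ (P e) * ΣT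
      ≡⟨ cong₂ (λ a b → suc t * (toℕ (Q e) * (cP * (suc k * k !)) + t * cP * cQ * k !) + a + toℕ (P e) * b)
               (d*ΣG d t+d≡) (sum-count-take Q q (suc k) (suc t) lenq (s≤s (≤-pred 1+t≤))) ⟩
    suc t * (toℕ (Q e) * (cP * (suc k * k !)) + t * cP * cQ * k !) + d * (suc t * cP * cQ * k !)
      + toℕ (P e) * (suc t * cQ * (suc k * k !))
      ≡⟨ cong (λ l → suc t * (toℕ (Q e) * (cP * (l * k !)) + t * cP * cQ * k !) + d * (suc t * cP * cQ * k !)
                     + toℕ (P e) * (suc t * cQ * (l * k !))) t+d≡ ⟨
    suc t * (toℕ (Q e) * (cP * ((t + d) * k !)) + t * cP * cQ * k !) + d * (suc t * cP * cQ * k !)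
      + toℕ (P e) * (suc t * cQ * ((t + d) * k !))
      ≡⟨ regroup t d (toℕ (P e)) (toℕ (Q e)) cP cQ (k !) (trans (sym (toℕ-∧ (P e) (Q e))) (cong toℕ (disjoint e))) ⟩
    suc t * (toℕ (P e) + cP) * (toℕ (Q e) + cQ) * ((t + d) * k !)
      ≡⟨ cong (λ l → suc t * (toℕ (P e) + cP) * (toℕ (Q e) + cQ) * (l * k !)) t+d≡ ⟩
    suc t * (toℕ (P e) + cP) * (toℕ (Q e) + cQ) * (suc k * k !) ∎
    where
    open ≡-Reasoning
    lenq : length q ≡ suc (suc k)
    lenq = suc-injective len
    cP = count P q
    cQ = count Q q
    ΣG : ℕ → ℕ
    ΣG t = sum (map (G t) (arrangements q))
    ΣT = sum (map (T (suc t)) (arrangements q))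
    d*ΣG : ∀ d → t + d ≡ suc k → d * ΣG (suc t) ≡ d * (suc t * cP * cQ * k !)
    d*ΣG zero     _    = refl
    d*ΣG (suc d′) t+d≡ = cong (suc d′ *_) (sum-lastIs*count-take disjoint q k (suc t) lenq
                                             (subst (suc t ≤_) (trans (sym (+-suc t d′)) t+d≡) (s≤s (m≤m+n t d′))))
    -- expanding the right-hand side gives the extra term pe * qe, which vanishes by disjointness
    regroup : ∀ t d pe qe cP cQ K → pe * qe ≡ 0 →
      suc t * (qe * (cP * ((t + d) * K)) + t * cP * cQ * K) + d * (suc t * cP * cQ * K) + pe * (suc t * cQ * ((t + d) * K))
      ≡ suc t * (pe + cP) * (qe + cQ) * ((t + d) * K)
    regroup t d pe qe cP cQ K pe*qe≡0 = begin
      lhs                                   ≡⟨ +-identityʳ lhs ⟨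
      lhs + 0                               ≡⟨ cong (λ z → lhs + z) (trans (cong (u *_) pe*qe≡0) (*-zeroʳ u)) ⟨
      lhs + u * (pe * qe)                   ≡⟨ expand t d pe qe cP cQ K ⟩
      suc t * (pe + cP) * (qe + cQ) * ((t + d) * K) ∎
      where
      u = suc t * ((t + d) * K)
      lhs = suc t * (qe * (cP * ((t + d) * K)) + t * cP * cQ * K) + d * (suc t * cP * cQ * K) + pe * (suc t * cQ * ((t + d) * K))
      expand : ∀ t d pe qe cP cQ K →
        suc t * (qe * (cP * ((t + d) * K)) + t * cP * cQ * K) + d * (suc t * cP * cQ * K) + pe * (suc t * cQ * ((t + d) * K))
          + suc t * ((t + d) * K) * (pe * qe)
        ≡ suc t * (pe + cP) * (qe + cQ) * ((t + d) * K)
      expand = solve-∀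

fromℚᵘ-homo-* : ∀ u w → fromℚᵘ u *ℚ fromℚᵘ w ≡ fromℚᵘ (u ℚᵘ.* w)
fromℚᵘ-homo-* u w = trans (sym (fromℚᵘ-toℚᵘ _)) (fromℚᵘ-cong
  (ℚᵘ.≃-trans (toℚᵘ-homo-* (fromℚᵘ u) (fromℚᵘ w)) (ℚᵘ.*-cong (toℚᵘ-fromℚᵘ u) (toℚᵘ-fromℚᵘ w))))

fromℚᵘ-homo-+ : ∀ u w → fromℚᵘ u +ℚ fromℚᵘ w ≡ fromℚᵘ (u ℚᵘ.+ w)
fromℚᵘ-homo-+ u w = trans (sym (fromℚᵘ-toℚᵘ _)) (fromℚᵘ-cong
  (ℚᵘ.≃-trans (toℚᵘ-homo-+ (fromℚᵘ u) (fromℚᵘ w)) (ℚᵘ.+-cong (toℚᵘ-fromℚᵘ u) (toℚᵘ-fromℚᵘ w))))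

/-* : ∀ a b c d → ((+ a) / suc b) *ℚ ((+ c) / suc d) ≡ (+ (a * c)) / (suc b * suc d)
/-* a b c d = trans (fromℚᵘ-homo-* (mkℚᵘ (+ a) b) (mkℚᵘ (+ c) d)) (cong (λ z → z / (suc b * suc d)) (sym (pos-* a c)))

/-+ : ∀ a b c d → ((+ a) / suc b) +ℚ ((+ c) / suc d) ≡ (+ (a * suc d + c * suc b)) / (suc b * suc d)
/-+ a b c d = trans (fromℚᵘ-homo-+ (mkℚᵘ (+ a) b) (mkℚᵘ (+ c) d))
  (cong (λ z → z / (suc b * suc d)) (trans (cong₂ ℤ._+_ (sym (pos-* a (suc d))) (sym (pos-* c (suc b))))
                                            (sym (pos-+ (a * suc d) (c * suc b)))))

/-cross : ∀ a b c d → a * suc d ≡ c * suc b → (+ a) / suc b ≡ (+ c) / suc d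
/-cross a b c d eq = fromℚᵘ-cong {mkℚᵘ (+ a) b} {mkℚᵘ (+ c) d}
  (*≡* (trans (sym (pos-* a (suc d))) (trans (cong +_ eq) (pos-* c (suc b)))))

mean-≡ : ∀ xs c d → 1 ≤ length xs → sum xs * suc d ≡ c * length xs → mean xs ≡ (+ c) / suc d
mean-≡ (x ∷ xs) c d _ eq = /-cross (sum (x ∷ xs)) (length xs) c d eq

avgSwaps-≡ : ∀ scheme n v ks c d →
             sum (map (λ p → scheme n (toArr v p)) (arrangements ks)) * suc d ≡ c * length ks ! →
             avgSwaps scheme n v ks ≡ (+ c) / suc d
avgSwaps-≡ scheme n v ks c d eq =
  mean-≡ (map (λ p → scheme n (toArr v p)) (arrangements ks)) c d (subst (1 ≤_) (sym len) (1≤n! (length ks)))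
         (trans eq (cong (c *_) (sym len)))
  where
  len : length (map (λ p → scheme n (toArr v p)) (arrangements ks)) ≡ length ks !
  len = trans (length-map _ (arrangements ks)) (length-arrangements ks)

-- Average numbers of exchanges

-- Scheme A makes b + T (j ∸ b) exchanges (b = 1 iff the last key is small); this removes b from the argument of T
swapsA-split : ∀ b (T : ℕ → ℕ) j → toℕ b + T (j ∸ toℕ b) + toℕ b * T j ≡ toℕ b + toℕ b * T (j ∸ 1) + T j
swapsA-split false T j = +-identityʳ (T j)
swapsA-split true  T j = regroup (T (j ∸ 1)) (T j)
  where
  regroup : ∀ a b → 1 + a + 1 * b ≡ 1 + 1 * a + b
  regroup = solve-∀

formulaA-fraction : ∀ k j → let ℓ = suc (suc k) ∸ j in
  formulaA (3 + k) j ≡ (+ (j * ℓ * k * suc (suc k) + j * (suc (suc k) * suc k))) / (suc (suc k) * suc k * suc (suc k))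
formulaA-fraction k j = trans (cong (_+ℚ ((+ j) / suc (suc k))) (/-* (j * (suc (suc k) ∸ j)) (suc k) k k))
                              (/-+ (j * (suc (suc k) ∸ j) * k) _ j (suc k))

avgSwapsA-single : ∀ v a → v ≢ a → avgSwaps swapsA 2 v (a ∷ []) ≡ formulaA 2 (count (small v) (a ∷ []))
avgSwapsA-single v a v≢a = avgSwaps-≡ swapsA 2 v (a ∷ []) (toℕ b + 0) 0 (begin
  (swapsA 2 (toArr v (a ∷ [])) + 0) * 1
    ≡⟨ cong (λ s → (s + 0) * 1) (swapsA-toArr v (a ∷ []) (v≢a ∷ []) 0 refl) ⟩
  (toℕ b + count (large v) (take ((toℕ b + 0) ∸ toℕ b) (a ∷ [])) + 0) * 1
    ≡⟨ cong (λ t → (toℕ b + count (large v) (take t (a ∷ [])) + 0) * 1) (m+n∸m≡n (toℕ b) 0) ⟩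
  (toℕ b + 0 + 0) * 1
    ≡⟨ cong (_* 1) (+-identityʳ (toℕ b + 0)) ⟩
  (toℕ b + 0) * 1 ∎)
  where
  open ≡-Reasoning
  b = small v a

module _ (v : ℕ) (ks : List ℕ) (v∉ks : All (v ≢_) ks) where

  private
    j = count (small v) ks
    ℓ = count (large v) ks
    arrs = arrangements ks

    L : List ℕ → ℕ
    L p = toℕ (lastIs (small v) p)
    T : ℕ → List ℕ → ℕ
    T t p = count (large v) (take t p)
    G : ℕ → List ℕ → ℕ
    G t p = L p * T t p

    v∉ : ∀ {p} → p ↭ ks → All (v ≢_) p
    v∉ p↭ = All-resp-↭ (↭.↭-sym p↭) v∉ks

    length≡ : ∀ {p m} → p ↭ ks → length ks ≡ m → length p ≡ m
    length≡ p↭ len = trans (↭-length p↭) len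

    smalls≡ : ∀ {p} → p ↭ ks → count (small v) p ≡ j
    smalls≡ = count-↭ (small v)

    j+ℓ≡ : j + ℓ ≡ length ks
    j+ℓ≡ = count-complement (small v) ks

    ℓ≡ : ∀ {m} → length ks ≡ m → ℓ ≡ m ∸ j
    ℓ≡ len = trans (sym (m+n∸m≡n j ℓ)) (cong (_∸ j) (trans j+ℓ≡ len))

  avgSwapsD : ∀ m → length ks ≡ m → avgSwaps swapsD (suc m) v ks ≡ (+ j) / 1
  avgSwapsD m len = avgSwaps-≡ swapsD (suc m) v ks j 0 (begin
    sum (map (λ p → swapsD (suc m) (toArr v p)) arrs) * 1
      ≡⟨ cong (_* 1) (sum-map-cong (All.map swapsD≡j (arrangements-↭ ks))) ⟩
    sum (map (λ _ → j) arrs) * 1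
      ≡⟨ cong (_* 1) (trans (sum-map-const j arrs) (cong (_* j) (length-arrangements ks))) ⟩
    length ks ! * j * 1
      ≡⟨ trans (*-identityʳ _) (*-comm (length ks !) j) ⟩
    j * length ks ! ∎)
    where
    open ≡-Reasoning
    swapsD≡j : ∀ {p} → p ↭ ks → swapsD (suc m) (toArr v p) ≡ j
    swapsD≡j p↭ = trans (swapsD-toArr v _ m (length≡ p↭ len)) (smalls≡ p↭)

  avgSwaps-misplaced : ∀ k scheme → length ks ≡ suc k →
    (∀ {p} → p ↭ ks → scheme (suc (suc k)) (toArr v p) ≡ T (count (small v) p) p) →
    avgSwaps scheme (suc (suc k)) v ks ≡ formulaBC (suc (suc k)) j
  avgSwaps-misplaced k scheme len per-arrangement = avgSwaps-≡ scheme (suc (suc k)) v ks (j * (suc k ∸ j)) k (begin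
    sum (map (λ p → scheme (suc (suc k)) (toArr v p)) arrs) * suc k
      ≡⟨ cong (_* suc k) (sum-map-cong (All.map scheme≡T (arrangements-↭ ks))) ⟩
    sum (map (T j) arrs) * suc k
      ≡⟨ cong (_* suc k) (sum-count-take (large v) ks k j len (subst (j ≤_) len (count-≤-length (small v) ks))) ⟩
    j * ℓ * k ! * suc k
      ≡⟨ regroup j ℓ (k !) k ⟩
    j * ℓ * suc k !
      ≡⟨ cong₂ (λ l n → j * l * n !) (ℓ≡ len) (sym len) ⟩
    j * (suc k ∸ j) * length ks ! ∎)
    where
    open ≡-Reasoning
    scheme≡T : ∀ {p} → p ↭ ks → scheme (suc (suc k)) (toArr v p) ≡ T j p
    scheme≡T {p} p↭ = trans (per-arrangement p↭) (cong (λ t → T t p) (smalls≡ p↭))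
    regroup : ∀ j ℓ K k → j * ℓ * K * suc k ≡ j * ℓ * (K + k * K)
    regroup = solve-∀

  avgSwapsB : ∀ k → length ks ≡ suc k → avgSwaps swapsB (suc (suc k)) v ks ≡ formulaBC (suc (suc k)) j
  avgSwapsB k len = avgSwaps-misplaced k swapsB len (λ p↭ → swapsB-toArr v _ (v∉ p↭) (suc k) (length≡ p↭ len))

  avgSwapsC : ∀ k → length ks ≡ suc k → avgSwaps swapsC (suc (suc k)) v ks ≡ formulaBC (suc (suc k)) j
  avgSwapsC k len = avgSwaps-misplaced k swapsC len (λ p↭ → swapsC-toArr v _ (v∉ p↭) (suc k) (length≡ p↭ len))

  module _ (k : ℕ) (len : length ks ≡ suc (suc k)) where

    private
      j≤ : j ≤ suc (suc k)
      j≤ = subst (j ≤_) len (count-≤-length (small v) ks)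

    sum-G : ∀ t → t ≤ suc k → sum (map (G t) arrs) ≡ t * j * ℓ * k !
    sum-G t t≤ = sum-lastIs*count-take (small v) (large v) (λ a → ∧-inverseʳ (small v a)) ks k t len t≤

    -- when all keys are small (j = k + 2) there are no large keys to count
    sum-G-j : sum (map (G j) arrs) ≡ j * j * ℓ * k !
    sum-G-j with j ≤? suc k
    ... | yes j≤1+k = sum-G j j≤1+k
    ... | no  j≰1+k = begin
      sum (map (G j) arrs)     ≡⟨ sum-map-cong (All.map G≡0 (arrangements-↭ ks)) ⟩
      sum (map (λ _ → 0) arrs) ≡⟨ sum-map-0 arrs (λ _ → refl) ⟩
      0                        ≡⟨ cong (_* k !) (*-zeroʳ (j * j)) ⟨
      j * j * 0 * k !          ≡⟨ cong (λ l → j * j * l * k !) ℓ≡0 ⟨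
      j * j * ℓ * k !          ∎
      where
      open ≡-Reasoning
      ℓ≡0 : ℓ ≡ 0
      ℓ≡0 = trans (ℓ≡ len) (trans (cong (suc (suc k) ∸_) (≤-antisym j≤ (≰⇒> j≰1+k))) (n∸n≡0 (suc (suc k))))
      G≡0 : ∀ {p} → p ↭ ks → G j p ≡ 0
      G≡0 {p} p↭ = trans (cong (L p *_) (n≤0⇒n≡0 (≤-trans (count-take-≤ (large v) j p)
                                                      (≤-reflexive (trans (count-↭ (large v) p↭) ℓ≡0)))))
                         (*-zeroʳ (L p))

    sum-swapsA+sum-G : sum (map (λ p → swapsA (3 + k) (toArr v p)) arrs) + sum (map (G j) arrs)
                       ≡ j * suc k ! + (j ∸ 1) * j * ℓ * k ! + j * ℓ * suc k !
    sum-swapsA+sum-G = begin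
      sum (map (λ p → swapsA (3 + k) (toArr v p)) arrs) + sum (map (G j) arrs)
        ≡⟨ sum-map-+ (λ p → swapsA (3 + k) (toArr v p)) (G j) arrs ⟨
      sum (map (λ p → swapsA (3 + k) (toArr v p) + G j p) arrs)
        ≡⟨ sum-map-cong (All.map (λ {p} → pointwise p) (arrangements-↭ ks)) ⟩
      sum (map (λ p → L p + G (j ∸ 1) p + T j p) arrs)
        ≡⟨ trans (sum-map-+ _ (T j) arrs) (cong (_+ sum (map (T j) arrs)) (sum-map-+ L (G (j ∸ 1)) arrs)) ⟩
      sum (map L arrs) + sum (map (G (j ∸ 1)) arrs) + sum (map (T j) arrs)
        ≡⟨ cong₂ _+_ (cong₂ _+_ (sum-lastIs (small v) ks (suc k) len) (sum-G (j ∸ 1) (∸-monoˡ-≤ 1 j≤)))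
                     (sum-count-take (large v) ks (suc k) j len j≤) ⟩
      j * suc k ! + (j ∸ 1) * j * ℓ * k ! + j * ℓ * suc k ! ∎
      where
      open ≡-Reasoning
      pointwise : ∀ p → p ↭ ks → swapsA (3 + k) (toArr v p) + G j p ≡ L p + G (j ∸ 1) p + T j p
      pointwise p p↭ = begin
        swapsA (3 + k) (toArr v p) + G j p
                                                    ≡⟨ cong (_+ G j p) (swapsA-toArr v p (v∉ p↭) (suc k) (length≡ p↭ len)) ⟩
        L p + T (count (small v) p ∸ L p) p + G j p ≡⟨ cong (λ t → L p + T (t ∸ L p) p + G j p) (smalls≡ p↭) ⟩
        L p + T (j ∸ L p) p + G j p                 ≡⟨ swapsA-split (lastIs (small v) p) (λ t → T t p) j ⟩
        L p + G (j ∸ 1) p + T j p                   ∎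

    sum-swapsA : sum (map (λ p → swapsA (3 + k) (toArr v p)) arrs) ≡ j * suc k ! + j * ℓ * k * k !
    sum-swapsA = cancel j ℓ (k !) X (trans (cong (λ g → X + g) (sym sum-G-j)) sum-swapsA+sum-G)
      where
      X = sum (map (λ p → swapsA (3 + k) (toArr v p)) arrs)
      -- j ∸ 1 truncates at j = 0, so that case is separate
      cancel : ∀ j ℓ K X → X + j * j * ℓ * K ≡ j * (K + k * K) + (j ∸ 1) * j * ℓ * K + j * ℓ * (K + k * K) →
               X ≡ j * (K + k * K) + j * ℓ * k * K
      cancel zero     ℓ K X eq = trans (sym (+-identityʳ X)) eq
      cancel (suc j′) ℓ K X eq = +-cancelʳ-≡ (suc j′ * suc j′ * ℓ * K) X _ (trans eq (regroup j′ ℓ k K))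
        where
        regroup : ∀ j′ ℓ k K → suc j′ * (K + k * K) + j′ * suc j′ * ℓ * K + suc j′ * ℓ * (K + k * K)
                               ≡ suc j′ * (K + k * K) + suc j′ * ℓ * k * K + suc j′ * suc j′ * ℓ * K
        regroup = solve-∀

    avgSwapsA-≥3 : avgSwaps swapsA (3 + k) v ks ≡ formulaA (3 + k) j
    avgSwapsA-≥3 = trans (avgSwaps-≡ swapsA (3 + k) v ks numerator _ (begin
      sum (map (λ p → swapsA (3 + k) (toArr v p)) arrs) * (suc (suc k) * suc k * suc (suc k))
        ≡⟨ cong (_* (suc (suc k) * suc k * suc (suc k))) sum-swapsA ⟩
      (j * suc k ! + j * ℓ * k * k !) * (suc (suc k) * suc k * suc (suc k))
        ≡⟨ regroup j ℓ k (k !) ⟩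
      (j * ℓ * k * suc (suc k) + j * (suc (suc k) * suc k)) * suc (suc k) !
        ≡⟨ cong₂ (λ l n → (j * l * k * suc (suc k) + j * (suc (suc k) * suc k)) * n !) (ℓ≡ len) (sym len) ⟩
      numerator * length ks ! ∎))
      (sym (formulaA-fraction k j))
      where
      open ≡-Reasoning
      numerator = j * (suc (suc k) ∸ j) * k * suc (suc k) + j * (suc (suc k) * suc k)
      regroup : ∀ j ℓ k K → (j * (K + k * K) + j * ℓ * k * K) * (suc (suc k) * suc k * suc (suc k))
                            ≡ (j * ℓ * k * suc (suc k) + j * (suc (suc k) * suc k)) * ((K + k * K) + suc k * (K + k * K))
      regroup = solve-∀

avgSwapsA : ∀ v ks k → length ks ≡ suc k → All (v ≢_) ks →
            avgSwaps swapsA (suc (suc k)) v ks ≡ formulaA (suc (suc k)) (count (small v) ks)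
avgSwapsA v (a ∷ []) zero    _   (v≢a ∷ []) = avgSwapsA-single v a v≢a
avgSwapsA v ks       (suc k) len v∉ks       = avgSwapsA-≥3 v ks v∉ks k len

lemma1 : (n j v : ℕ) (ks : List ℕ) → 2 ≤ n → j ≤ n ∸ 1 →
    length ks ≡ n ∸ 1 → Unique (v ∷ ks) → length (filter (_<? v) ks) ≡ j →
    (avgSwaps swapsA n v ks ≡ formulaA n j) ×
    (avgSwaps swapsB n v ks ≡ formulaBC n j) ×
    (avgSwaps swapsC n v ks ≡ formulaBC n j) ×
    (avgSwaps swapsD n v ks ≡ (+ j) / 1)
lemma1 (suc (suc k)) j v ks (s≤s (s≤s z≤n)) _ len (v∉ks ∷ _) smalls
  with refl ← trans (sym (length-filter-<? v ks)) smalls =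
  avgSwapsA v ks k len v∉ks , avgSwapsB v ks v∉ks k len , avgSwapsC v ks v∉ks k len , avgSwapsD v ks v∉ks (suc k) len
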